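{- As formal power series in $q$, $$\sum_{n=0}^{\infty}\sigma_d\mathrm{moex}(n)q^n=(-q;q)_\infty\left(1+2\sum_{n=1}^{\infty}\frac{q^{n^2}}{(-q;q^2)_n}\right)=(-q;q)_\infty\left(1+2\sum_{n=1}^{\infty}(-1)^{n-1}q^n(q^2;q^2)_{n-1}\right).$$ Equivalently, $\sum_{n=0}^{\infty}\sigma_d\mathrm{moex}(n)q^n=(-q;q)_\infty\left(1+\sigma^*(-q)\right)$, where $\sigma^*(q):=2\sum_{n=1}^{\infty}\frac{(-1)^nq^{n^2}}{(q;q^2)_n}$.
   Context: For a partition $\pi$, $\mathrm{moex}(\pi)$ is the smallest odd positive integer that is not a part of $\pi$ (the empty partition has $\mathrm{moex}=1$). Let $\mathcal{D}(n)$ be the set of partitions of $n$ into distinct parts and $\sigma_d\mathrm{moex}(n):=\sum_{\pi\in\mathcal{D}(n)}\mathrm{moex}(\pi)$. Notation: $(a;q)_0=1$, $(a;q)_n=\prod_{j=0}^{n-1}(1-aq^j)$, $(a;q)_\infty=\prod_{j\ge0}(1-aq^j)$. -}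

module Defs where

open import Data.Nat as ℕ using (ℕ; zero; suc; _<_)
open import Data.Integer as ℤ using (ℤ; +_; -_; _+_; _*_; _-_)
open import Data.List using (List; []; _∷_; length; map; zipWith; upTo; foldr)
open import Data.Nat.ListAction using (sum)
open import Data.List.Relation.Unary.All using (All)
open import Data.List.Relation.Unary.Linked using (Linked)
open import Data.List.Membership.DecPropositional ℕ._≟_ using (_∈?_)
open import Relation.Nullary using (yes; no)
open import Relation.Binary.PropositionalEquality using (_≡_)
open import Data.Product using (_×_)

IsDistinctPartition : ℕ → List ℕ → Set
IsDistinctPartition n π = (sum π ≡ n) × All (0 <_) π × Linked ℕ._>_ π

-- moex π: smallest odd positive integer not a part of π.
-- Searches the candidates 1, 3, 5, ..., 2·length π + 1; at least one of
-- these length π + 1 values is missing from π, so the search is exhaustive.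
moexAux : List ℕ → ℕ → ℕ → ℕ
moexAux π zero c = c
moexAux π (suc f) c with c ∈? π
... | yes _ = moexAux π f (2 ℕ.+ c)
... | no  _ = c

moex : List ℕ → ℕ
moex π = moexAux π (suc (length π)) 1

Series : Set
Series = ℕ → ℤ

sumTo : ℕ → (ℕ → ℤ) → ℤ
sumTo zero f = f 0
sumTo (suc n) f = sumTo n f + f (suc n)

𝟙 : Series
𝟙 zero = + 1
𝟙 (suc _) = + 0

X : Series
X 1 = + 1
X _ = + 0

_⊕_ : Series → Series → Series
(f ⊕ g) n = f n + g n

_⊖_ : Series → Series → Series
(f ⊖ g) n = f n - g n

scale : ℤ → Series → Series
scale c f n = c * f n

_⊛_ : Series → Series → Series
(f ⊛ g) n = sumTo n (λ k → f k * g (n ℕ.∸ k))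

pow : Series → ℕ → Series
pow f zero = 𝟙
pow f (suc k) = f ⊛ pow f k

prodTo : ℕ → (ℕ → Series) → Series
prodTo zero F = 𝟙
prodTo (suc n) F = prodTo n F ⊛ F n

sgn : ℕ → ℤ
sgn zero = + 1
sgn (suc n) = - sgn n

-- multiplicative inverse of a series f with f 0 = 1.
-- invCoeffs f n = [g n, g (n-1), ..., g 0] where g 0 = 1 and
-- g m = - Σ_{k=1}^{m} f k * g (m - k).
invCoeffs : Series → ℕ → List ℤ
invCoeffs f zero = + 1 ∷ []
invCoeffs f (suc n) =
  let gs = invCoeffs f n in
  (- foldr _+_ (+ 0) (zipWith _*_ (map (λ k → f (suc k)) (upTo (suc n))) gs)) ∷ gs

inv : Series → Series
inv f n with invCoeffs f n
... | g ∷ _ = g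
... | []    = + 0

poch : Series → Series → ℕ → Series
poch a b n = prodTo n (λ j → 𝟙 ⊖ (a ⊛ pow b j))

-- (a;b)_∞ for a, b of positive valuation: its q^N coefficient equals that
-- of the partial product (a;b)_{N+1} (all further factors are ≡ 1 mod q^{N+1}).
pochInf : Series → Series → Series
pochInf a b N = poch a b (suc N) N

-- Σ_{n≥1} F n for a family with F n of valuation ≥ n: the q^N coefficient
-- is Σ_{n=1}^{N} [q^N] F n.
infSum1 : (ℕ → Series) → Series
infSum1 F N = sumTo N (λ { zero → + 0 ; (suc m) → F (suc m) N })

subNeg : Series → Series
subNeg f n = sgn n * f n

minusQ : Series
minusQ = scale (- + 1) X

seriesA : Series
seriesA = pochInf minusQ X ⊛
  (𝟙 ⊕ scale (+ 2) (infSum1 (λ n → pow X (n ℕ.* n) ⊛ inv (poch minusQ (pow X 2) n))))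

seriesB : Series
seriesB = pochInf minusQ X ⊛
  (𝟙 ⊕ scale (+ 2) (infSum1 (λ n → scale (sgn (n ℕ.∸ 1)) (pow X n ⊛ poch (pow X 2) (pow X 2) (n ℕ.∸ 1)))))

sigmaStar : Series
sigmaStar = scale (+ 2) (infSum1 (λ n → scale (sgn n) (pow X (n ℕ.* n) ⊛ inv (poch X (pow X 2) n))))

seriesC : Series
seriesC = pochInf minusQ X ⊛ (𝟙 ⊕ subNeg sigmaStar)

-- Since moex π = 1 + 2 · #{j ≥ 0 : 1, 3, …, 2j + 1 are parts of π}, the generating function of
-- σ_d moex is (-q;q)∞ + 2 Σ_{j≥0} G_j, where G_j counts distinct partitions containing
-- 1, 3, …, 2j + 1. Forcing these parts replaces their factors 1 + q^(2t+1) in (-q;q)∞ by q^(2t+1),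
-- so G_j = q^((j+1)²) (-q;q)∞ / (-q;q²)_{j+1}: this is the first form. Substituting q ↦ -q turns
-- σ*(-q) termwise into the same sum. The second form comes from iterating Fine's functional
-- equation (1 - z) F(z) = 1 - z q² F(z q²), F(z) = Σ (q²;q²)ₙ zⁿ, at z = -q, -q³, -q⁵, ….

module Submission where

open import Defs
open import Data.Bool using (Bool; true; false; if_then_else_)
open import Data.Integer as ℤ using (ℤ; +_; -_; _+_; _*_; _-_)
import Data.Integer.Properties as ℤₚ
open import Data.Integer.Tactic.RingSolver using (solve-∀)
open import Data.List using (List; []; _∷_; _++_; map; filter; length; zipWith; foldr; applyUpTo; upTo)
open import Data.List.Membership.Propositional using (_∈_)
open import Data.List.Membership.Propositional.Properties
  using (∈-map⁺; ∈-map⁻; ∈-++⁺ˡ; ∈-++⁺ʳ; ∈-++⁻; ∈-filter⁺; ∈-filter⁻)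
open import Data.List.Membership.Propositional.Properties.WithK using (unique∧set⇒bag)
open import Data.List.Properties using (∷-injectiveʳ; filter-accept; filter-reject)
open import Data.List.Relation.Binary.BagAndSetEquality using (∼bag⇒↭)
open import Data.List.Relation.Binary.Permutation.Propositional
  using (_↭_; prep; swap) renaming (refl to ↭-refl; trans to ↭-trans)
open import Data.List.Relation.Unary.All as All using (All; []; _∷_)
open import Data.List.Relation.Unary.Any using (here; there)
open import Data.List.Relation.Unary.Linked as Linked using (Linked; []; [-]; _∷_)
open import Data.List.Relation.Unary.Unique.Propositional using (Unique; []; _∷_)
import Data.List.Relation.Unary.Unique.Propositional.Properties as Uniqueₚ
open import Data.Maybe using (Maybe; just; nothing)
open import Data.Nat as ℕ using (ℕ; zero; suc; _∸_; _≤_; _<_; z≤n; s≤s)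
open import Data.List.Membership.DecPropositional ℕ._≟_ using (_∈?_)
open import Data.Nat.ListAction using (sum)
import Data.Nat.Properties as ℕₚ
open import Data.Nat.Tactic.RingSolver as ℕ-Solver using ()
open import Data.Product using (_×_; _,_)
open import Data.Sum using (_⊎_; inj₁; inj₂)
open import Function using (_∘_; id)
open import Function.Bundles using (_⇔_; mk⇔; Equivalence)
open import Algebra.Structures using (IsCommutativeMonoid)
open import Algebra.Structures.Biased using (module IsCommutativeSemiringˡ)
open import Algebra.Solver.Ring.AlmostCommutativeRing
  using (AlmostCommutativeRing; _-Raw-AlmostCommutative⟶_)
open import Relation.Binary.Bundles using (Setoid)
open import Relation.Binary.Structures using (IsEquivalence)
open import Relation.Binary.PropositionalEquality
import Relation.Binary.Reasoning.Setoid
open import Relation.Nullary using (Dec; yes; no; ¬_; does; contradiction)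
open import Relation.Nullary.Decidable using (dec-true; dec-false)

+-interchange : ∀ a b c d → (a + b) + (c + d) ≡ (a + c) + (b + d)
+-interchange = solve-∀

sumTo-cong≤ : ∀ n {f g : ℕ → ℤ} → (∀ k → k ≤ n → f k ≡ g k) → sumTo n f ≡ sumTo n g
sumTo-cong≤ zero eq = eq 0 z≤n
sumTo-cong≤ (suc n) eq =
  cong₂ _+_ (sumTo-cong≤ n (λ k k≤n → eq k (ℕₚ.m≤n⇒m≤1+n k≤n))) (eq (suc n) ℕₚ.≤-refl)

sumTo-cong : ∀ n {f g : ℕ → ℤ} → (∀ k → f k ≡ g k) → sumTo n f ≡ sumTo n g
sumTo-cong n eq = sumTo-cong≤ n (λ k _ → eq k)

sumTo-zero : ∀ n {f : ℕ → ℤ} → (∀ k → k ≤ n → f k ≡ + 0) → sumTo n f ≡ + 0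
sumTo-zero n eq = trans (sumTo-cong≤ n eq) (sumTo-const0 n)
  where
  sumTo-const0 : ∀ n → sumTo n (λ _ → + 0) ≡ + 0
  sumTo-const0 zero = refl
  sumTo-const0 (suc n) = cong (_+ + 0) (sumTo-const0 n)

sumTo-+ : ∀ n (f g : ℕ → ℤ) → sumTo n (λ k → f k + g k) ≡ sumTo n f + sumTo n g
sumTo-+ zero f g = refl
sumTo-+ (suc n) f g =
  trans (cong (_+ (f (suc n) + g (suc n))) (sumTo-+ n f g)) (+-interchange (sumTo n f) (sumTo n g) (f (suc n)) (g (suc n)))

*-distribˡ-sumTo : ∀ n c (f : ℕ → ℤ) → c * sumTo n f ≡ sumTo n (λ k → c * f k)
*-distribˡ-sumTo zero c f = refl
*-distribˡ-sumTo (suc n) c f =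
  trans (ℤₚ.*-distribˡ-+ c (sumTo n f) (f (suc n))) (cong (_+ c * f (suc n)) (*-distribˡ-sumTo n c f))

*-distribʳ-sumTo : ∀ n c (f : ℕ → ℤ) → sumTo n f * c ≡ sumTo n (λ k → f k * c)
*-distribʳ-sumTo n c f = begin
  sumTo n f * c            ≡⟨ ℤₚ.*-comm (sumTo n f) c ⟩
  c * sumTo n f            ≡⟨ *-distribˡ-sumTo n c f ⟩
  sumTo n (λ k → c * f k)  ≡⟨ sumTo-cong n (λ k → ℤₚ.*-comm c (f k)) ⟩
  sumTo n (λ k → f k * c)  ∎
  where open ≡-Reasoning

sumTo-suc : ∀ n (f : ℕ → ℤ) → sumTo (suc n) f ≡ f 0 + sumTo n (λ k → f (suc k))
sumTo-suc zero f = refl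
sumTo-suc (suc n) f =
  trans (cong (_+ f (suc (suc n))) (sumTo-suc n f)) (ℤₚ.+-assoc (f 0) _ _)

sumTo-reverse : ∀ n (f : ℕ → ℤ) → sumTo n f ≡ sumTo n (λ k → f (n ∸ k))
sumTo-reverse zero f = refl
sumTo-reverse (suc n) f = begin
  sumTo n f + f (suc n)                    ≡⟨ ℤₚ.+-comm (sumTo n f) (f (suc n)) ⟩
  f (suc n) + sumTo n f                    ≡⟨ cong (_+_ (f (suc n))) (sumTo-reverse n f) ⟩
  f (suc n) + sumTo n (λ k → f (n ∸ k))    ≡⟨ sumTo-suc n (λ k → f (suc n ∸ k)) ⟨
  sumTo (suc n) (λ k → f (suc n ∸ k))      ∎
  where open ≡-Reasoning

sumTo-extend : ∀ L K (f : ℕ → ℤ) → L ≤ K → (∀ j → L < j → f j ≡ + 0) → sumTo K f ≡ sumTo L f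
sumTo-extend L zero f z≤n _ = refl
sumTo-extend L (suc K) f L≤1+K vanish with L ℕ.≟ suc K
... | yes refl = refl
... | no L≢1+K = begin
  sumTo K f + f (suc K)  ≡⟨ cong₂ _+_ (sumTo-extend L K f (ℕₚ.≤-pred L<1+K) vanish) (vanish (suc K) L<1+K) ⟩
  sumTo L f + + 0        ≡⟨ ℤₚ.+-identityʳ _ ⟩
  sumTo L f              ∎
  where
  open ≡-Reasoning
  L<1+K = ℕₚ.≤∧≢⇒< L≤1+K L≢1+K

sumTo-triangle-swap : ∀ n (a : ℕ → ℕ → ℤ) →
  sumTo n (λ k → sumTo k (λ i → a i k)) ≡ sumTo n (λ i → sumTo (n ∸ i) (λ j → a i (i ℕ.+ j)))
sumTo-triangle-swap zero a = refl
sumTo-triangle-swap (suc n) a = begin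
  sumTo n (λ k → sumTo k (λ i → a i k)) + (sumTo n (λ i → a i (suc n)) + a (suc n) (suc n))
    ≡⟨ cong (_+ (sumTo n (λ i → a i (suc n)) + a (suc n) (suc n))) (sumTo-triangle-swap n a) ⟩
  R + (sumTo n (λ i → a i (suc n)) + a (suc n) (suc n))
    ≡⟨ ℤₚ.+-assoc R (sumTo n (λ i → a i (suc n))) (a (suc n) (suc n)) ⟨
  (R + sumTo n (λ i → a i (suc n))) + a (suc n) (suc n)
    ≡⟨ cong₂ _+_ (trans (sym (sumTo-cong≤ n row-suc)) (sumTo-+ n _ _)) (cong (a (suc n)) (ℕₚ.+-identityʳ (suc n))) ⟨
  sumTo n (λ i → sumTo (suc n ∸ i) (λ j → a i (i ℕ.+ j))) + a (suc n) (suc n ℕ.+ 0)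
    ≡⟨ cong (λ m → sumTo n (λ i → sumTo (suc n ∸ i) (λ j → a i (i ℕ.+ j))) + sumTo m (λ j → a (suc n) (suc n ℕ.+ j))) (ℕₚ.n∸n≡0 n) ⟨
  sumTo (suc n) (λ i → sumTo (suc n ∸ i) (λ j → a i (i ℕ.+ j))) ∎
  where
  open ≡-Reasoning
  R = sumTo n (λ i → sumTo (n ∸ i) (λ j → a i (i ℕ.+ j)))
  row-suc : ∀ i → i ≤ n →
    sumTo (n ∸ i) (λ j → a i (i ℕ.+ j)) + a i (suc n) ≡ sumTo (suc n ∸ i) (λ j → a i (i ℕ.+ j))
  row-suc i i≤n rewrite ℕₚ.+-∸-assoc 1 i≤n =
    cong (λ m → sumTo (n ∸ i) (λ j → a i (i ℕ.+ j)) + a i m)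
         (sym (trans (ℕₚ.+-suc i (n ∸ i)) (cong suc (ℕₚ.m+[n∸m]≡n i≤n))))

infix 4 _≈_
_≈_ : Series → Series → Set
f ≈ g = ∀ n → f n ≡ g n

≈-refl : ∀ {f} → f ≈ f
≈-refl n = refl

≈-sym : ∀ {f g} → f ≈ g → g ≈ f
≈-sym eq n = sym (eq n)

≈-trans : ∀ {f g h} → f ≈ g → g ≈ h → f ≈ h
≈-trans eq eq′ n = trans (eq n) (eq′ n)

≈-isEquivalence : IsEquivalence _≈_
≈-isEquivalence = record { refl = λ {f} → ≈-refl {f} ; sym = ≈-sym ; trans = ≈-trans }

seriesSetoid : Setoid _ _
seriesSetoid = record { isEquivalence = ≈-isEquivalence }

module ≈-Reasoning = Relation.Binary.Reasoning.Setoid seriesSetoid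

𝟘 : Series
𝟘 _ = + 0

negate : Series → Series
negate f n = - f n

⊕-cong : ∀ {f f′ g g′} → f ≈ f′ → g ≈ g′ → f ⊕ g ≈ f′ ⊕ g′
⊕-cong eq eq′ n = cong₂ _+_ (eq n) (eq′ n)

⊛-cong : ∀ {f f′ g g′} → f ≈ f′ → g ≈ g′ → f ⊛ g ≈ f′ ⊛ g′
⊛-cong eq eq′ n = sumTo-cong n (λ k → cong₂ _*_ (eq k) (eq′ (n ∸ k)))

⊛-congˡ : ∀ {f f′} g → f ≈ f′ → f ⊛ g ≈ f′ ⊛ g
⊛-congˡ g eq = ⊛-cong eq (≈-refl {g})

⊛-congʳ : ∀ f {g g′} → g ≈ g′ → f ⊛ g ≈ f ⊛ g′
⊛-congʳ f eq = ⊛-cong (≈-refl {f}) eq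

scale-cong : ∀ c {f g} → f ≈ g → scale c f ≈ scale c g
scale-cong c eq n = cong (c *_) (eq n)

⊛-comm : ∀ f g → f ⊛ g ≈ g ⊛ f
⊛-comm f g n = trans (sumTo-reverse n (λ k → f k * g (n ∸ k))) (sumTo-cong≤ n swap-factors)
  where
  swap-factors : ∀ k → k ≤ n → f (n ∸ k) * g (n ∸ (n ∸ k)) ≡ g k * f (n ∸ k)
  swap-factors k k≤n = trans (cong (λ m → f (n ∸ k) * g m) (ℕₚ.m∸[m∸n]≡n k≤n)) (ℤₚ.*-comm (f (n ∸ k)) (g k))

⊛-assoc : ∀ f g h → (f ⊛ g) ⊛ h ≈ f ⊛ (g ⊛ h)
⊛-assoc f g h n = begin
  sumTo n (λ k → sumTo k (λ i → f i * g (k ∸ i)) * h (n ∸ k))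
    ≡⟨ sumTo-cong n (λ k → *-distribʳ-sumTo k (h (n ∸ k)) (λ i → f i * g (k ∸ i))) ⟩
  sumTo n (λ k → sumTo k (λ i → f i * g (k ∸ i) * h (n ∸ k)))
    ≡⟨ sumTo-triangle-swap n (λ i k → f i * g (k ∸ i) * h (n ∸ k)) ⟩
  sumTo n (λ i → sumTo (n ∸ i) (λ j → f i * g ((i ℕ.+ j) ∸ i) * h (n ∸ (i ℕ.+ j))))
    ≡⟨ sumTo-cong n (λ i → trans (sumTo-cong (n ∸ i) (reindex i)) (sym (*-distribˡ-sumTo (n ∸ i) (f i) _))) ⟩
  sumTo n (λ i → f i * sumTo (n ∸ i) (λ j → g j * h (n ∸ i ∸ j))) ∎
  where
  open ≡-Reasoning
  reindex : ∀ i j → f i * g ((i ℕ.+ j) ∸ i) * h (n ∸ (i ℕ.+ j)) ≡ f i * (g j * h (n ∸ i ∸ j))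
  reindex i j = trans (cong₂ (λ a b → f i * g a * h b) (ℕₚ.m+n∸m≡n i j) (sym (ℕₚ.∸-+-assoc n i j)))
                      (ℤₚ.*-assoc (f i) (g j) (h (n ∸ i ∸ j)))

⊛-identityˡ : ∀ f → 𝟙 ⊛ f ≈ f
⊛-identityˡ f zero = ℤₚ.*-identityˡ (f 0)
⊛-identityˡ f (suc n) = begin
  sumTo (suc n) (λ k → 𝟙 k * f (suc n ∸ k))          ≡⟨ sumTo-suc n (λ k → 𝟙 k * f (suc n ∸ k)) ⟩
  + 1 * f (suc n) + sumTo n (λ k → + 0 * f (n ∸ k))   ≡⟨ cong₂ _+_ (ℤₚ.*-identityˡ (f (suc n))) (sumTo-zero n (λ _ _ → refl)) ⟩
  f (suc n) + + 0                                     ≡⟨ ℤₚ.+-identityʳ (f (suc n)) ⟩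
  f (suc n)                                           ∎
  where open ≡-Reasoning

⊛-identityʳ : ∀ f → f ⊛ 𝟙 ≈ f
⊛-identityʳ f = ≈-trans (⊛-comm f 𝟙) (⊛-identityˡ f)

⊛-zeroˡ : ∀ f → 𝟘 ⊛ f ≈ 𝟘
⊛-zeroˡ f n = sumTo-zero n (λ _ _ → refl)

⊛-distribʳ : ∀ f g h → (g ⊕ h) ⊛ f ≈ (g ⊛ f) ⊕ (h ⊛ f)
⊛-distribʳ f g h n =
  trans (sumTo-cong n (λ k → ℤₚ.*-distribʳ-+ (f (n ∸ k)) (g k) (h k))) (sumTo-+ n _ _)

negate-⊛ : ∀ f g → negate f ⊛ g ≈ negate (f ⊛ g)
negate-⊛ f g n = begin
  sumTo n (λ k → - f k * g (n ∸ k))       ≡⟨ sumTo-cong n (λ k → trans (ℤₚ.-1*i≡-i _) (ℤₚ.neg-distribˡ-* (f k) (g (n ∸ k)))) ⟨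
  sumTo n (λ k → - + 1 * (f k * g (n ∸ k))) ≡⟨ *-distribˡ-sumTo n (- + 1) (λ k → f k * g (n ∸ k)) ⟨
  - + 1 * sumTo n (λ k → f k * g (n ∸ k))  ≡⟨ ℤₚ.-1*i≡-i _ ⟩
  - sumTo n (λ k → f k * g (n ∸ k))        ∎
  where open ≡-Reasoning

⊛-scaleˡ : ∀ c f g → scale c f ⊛ g ≈ scale c (f ⊛ g)
⊛-scaleˡ c f g n =
  trans (sumTo-cong n (λ k → ℤₚ.*-assoc c (f k) (g (n ∸ k)))) (sym (*-distribˡ-sumTo n c _))

⊛-scaleʳ : ∀ c f g → f ⊛ scale c g ≈ scale c (f ⊛ g)
⊛-scaleʳ c f g n = begin
  (f ⊛ scale c g) n  ≡⟨ ⊛-comm f (scale c g) n ⟩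
  (scale c g ⊛ f) n  ≡⟨ ⊛-scaleˡ c g f n ⟩
  c * (g ⊛ f) n      ≡⟨ cong (c *_) (⊛-comm g f n) ⟩
  c * (f ⊛ g) n      ∎
  where open ≡-Reasoning

private
  isCommutativeMonoid : ∀ {_∙_ : Series → Series → Series} {e} →
    (∀ {f f′ g g′} → f ≈ f′ → g ≈ g′ → (f ∙ g) ≈ (f′ ∙ g′)) →
    (∀ f g h → ((f ∙ g) ∙ h) ≈ (f ∙ (g ∙ h))) →
    (∀ f → (e ∙ f) ≈ f) → (∀ f g → (f ∙ g) ≈ (g ∙ f)) → IsCommutativeMonoid _≈_ _∙_ e
  isCommutativeMonoid {_∙_} {e} ∙-cong ∙-assoc ∙-identityˡ ∙-comm = record
    { isMonoid = record
      { isSemigroup = record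
        { isMagma = record { isEquivalence = ≈-isEquivalence ; ∙-cong = ∙-cong }
        ; assoc = ∙-assoc }
      ; identity = ∙-identityˡ , λ f → ≈-trans (∙-comm f e) (∙-identityˡ f) }
    ; comm = ∙-comm }

seriesRing : AlmostCommutativeRing _ _
seriesRing = record
  { Carrier = Series ; _≈_ = _≈_ ; _+_ = _⊕_ ; _*_ = _⊛_ ; -_ = negate ; 0# = 𝟘 ; 1# = 𝟙
  ; isAlmostCommutativeRing = record
    { isCommutativeSemiring = IsCommutativeSemiringˡ.isCommutativeSemiring (record
      { +-isCommutativeMonoid = isCommutativeMonoid ⊕-cong
          (λ f g h n → ℤₚ.+-assoc (f n) (g n) (h n)) (λ f n → ℤₚ.+-identityˡ (f n)) (λ f g n → ℤₚ.+-comm (f n) (g n))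
      ; *-isCommutativeMonoid = isCommutativeMonoid ⊛-cong ⊛-assoc ⊛-identityˡ ⊛-comm
      ; distribʳ = ⊛-distribʳ
      ; zeroˡ = ⊛-zeroˡ })
    ; -‿cong = λ eq n → cong -_ (eq n)
    ; -‿*-distribˡ = negate-⊛
    ; -‿+-comm = λ f g n → sym (ℤₚ.neg-distrib-+ (f n) (g n))
    } }

-- Defined by cases so that the solver's constants 0 and 1 are 𝟘 and 𝟙 on the nose.
const : ℤ → Series
const (+ 0) = 𝟘
const (+ 1) = 𝟙
const c = scale c 𝟙

const≈scale : ∀ c → const c ≈ scale c 𝟙
const≈scale (+ 0) n = sym (ℤₚ.*-zeroˡ (𝟙 n))
const≈scale (+ 1) n = sym (ℤₚ.*-identityˡ (𝟙 n))
const≈scale (+ suc (suc k)) n = refl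
const≈scale ℤ.-[1+ k ] n = refl

scale≈const-⊛ : ∀ c f → scale c f ≈ const c ⊛ f
scale≈const-⊛ c f = ≈-sym (≈-trans (⊛-congˡ f (const≈scale c))
                          (≈-trans (⊛-scaleˡ c 𝟙 f) (scale-cong c (⊛-identityˡ f))))

private
  const-homomorphism : ℤ.+-*-rawRing -Raw-AlmostCommutative⟶ seriesRing
  const-homomorphism = record
    { ⟦_⟧ = const
    ; +-homo = λ a b n → trans (const≈scale (a + b) n)
        (trans (ℤₚ.*-distribʳ-+ (𝟙 n) a b) (sym (cong₂ _+_ (const≈scale a n) (const≈scale b n))))
    ; *-homo = λ a b n → trans (const≈scale (a * b) n) (sym (trans
        (⊛-cong (const≈scale a) (const≈scale b) n)
        (trans (⊛-scaleˡ a 𝟙 (scale b 𝟙) n)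
        (trans (cong (a *_) (trans (⊛-scaleʳ b 𝟙 𝟙 n) (cong (b *_) (⊛-identityˡ 𝟙 n))))
               (sym (ℤₚ.*-assoc a b (𝟙 n)))))))
    ; -‿homo = λ a n → trans (const≈scale (- a) n)
        (trans (sym (ℤₚ.neg-distribˡ-* a (𝟙 n))) (cong -_ (sym (const≈scale a n))))
    ; 0-homo = ≈-refl
    ; 1-homo = ≈-refl }

  const-≟ : ∀ a b → Maybe (const a ≈ const b)
  const-≟ a b with a ℤₚ.≟ b
  ... | yes refl = just ≈-refl
  ... | no _ = nothing

open import Algebra.Solver.Ring ℤ.+-*-rawRing seriesRing const-homomorphism const-≟
  using (solve; _:=_; con; _:+_; _:*_; :-_)

X^_ : ℕ → Series
(X^ zero) = 𝟙
(X^ suc k) zero = + 0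
(X^ suc k) (suc n) = (X^ k) n

shift : ℕ → Series → Series
shift zero f = f
shift (suc k) f zero = + 0
shift (suc k) f (suc n) = shift k f n

X^-⊛ : ∀ k f → (X^ k) ⊛ f ≈ shift k f
X^-⊛ zero f = ⊛-identityˡ f
X^-⊛ (suc k) f zero = refl
X^-⊛ (suc k) f (suc n) =
  trans (sumTo-suc n (λ i → (X^ suc k) i * f (suc n ∸ i))) (trans (ℤₚ.+-identityˡ _) (X^-⊛ k f n))

shift-X^ : ∀ a b → shift a (X^ b) ≈ X^ (a ℕ.+ b)
shift-X^ zero b = ≈-refl
shift-X^ (suc a) b zero = refl
shift-X^ (suc a) b (suc n) = shift-X^ a b n

X^-+ : ∀ a b → (X^ a) ⊛ (X^ b) ≈ X^ (a ℕ.+ b)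
X^-+ a b = ≈-trans (X^-⊛ a (X^ b)) (shift-X^ a b)

X^-cong : ∀ {a b} → a ≡ b → X^ a ≈ X^ b
X^-cong refl = ≈-refl

X^-diag : ∀ k → (X^ k) k ≡ + 1
X^-diag zero = refl
X^-diag (suc k) = X^-diag k

X^-off-diag : ∀ {a b} → a ≢ b → (X^ a) b ≡ + 0
X^-off-diag {zero} {zero} a≢b = contradiction refl a≢b
X^-off-diag {zero} {suc b} _ = refl
X^-off-diag {suc a} {zero} _ = refl
X^-off-diag {suc a} {suc b} a≢b = X^-off-diag (a≢b ∘ cong suc)

X≈X^1 : X ≈ X^ 1
X≈X^1 zero = refl
X≈X^1 (suc zero) = refl
X≈X^1 (suc (suc n)) = refl

pow-cong : ∀ {f g} k → f ≈ g → pow f k ≈ pow g k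
pow-cong zero eq = ≈-refl
pow-cong (suc k) eq = ⊛-cong eq (pow-cong k eq)

pow-X^ : ∀ a k → pow (X^ a) k ≈ X^ (a ℕ.* k)
pow-X^ a zero = X^-cong (sym (ℕₚ.*-zeroʳ a))
pow-X^ a (suc k) = ≈-trans (⊛-congʳ (X^ a) (pow-X^ a k))
                   (≈-trans (X^-+ a (a ℕ.* k)) (X^-cong (sym (ℕₚ.*-suc a k))))

pow-X : ∀ k → pow X k ≈ X^ k
pow-X k = ≈-trans (pow-cong k X≈X^1) (≈-trans (pow-X^ 1 k) (X^-cong (ℕₚ.*-identityˡ k)))

infix 4 _≈[_]_
_≈[_]_ : Series → ℕ → Series → Set
f ≈[ v ] g = ∀ n → n < v → f n ≡ g n

VanishesBelow : ℕ → Series → Set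
VanishesBelow v f = f ≈[ v ] 𝟘

≈⇒≈[] : ∀ {f g} v → f ≈ g → f ≈[ v ] g
≈⇒≈[] v eq n _ = eq n

≈[]-refl : ∀ {f v} → f ≈[ v ] f
≈[]-refl n _ = refl

≈[]-trans : ∀ {f g h v} → f ≈[ v ] g → g ≈[ v ] h → f ≈[ v ] h
≈[]-trans eq eq′ n n<v = trans (eq n n<v) (eq′ n n<v)

⊕-cong-≈[] : ∀ {f f′ g g′ v} → f ≈[ v ] f′ → g ≈[ v ] g′ → f ⊕ g ≈[ v ] f′ ⊕ g′
⊕-cong-≈[] eq eq′ n n<v = cong₂ _+_ (eq n n<v) (eq′ n n<v)

⊛-cong-≈[] : ∀ {f f′ g g′ v} → f ≈[ v ] f′ → g ≈[ v ] g′ → f ⊛ g ≈[ v ] f′ ⊛ g′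
⊛-cong-≈[] eq eq′ n n<v = sumTo-cong≤ n λ k k≤n →
  cong₂ _*_ (eq k (ℕₚ.≤-<-trans k≤n n<v)) (eq′ (n ∸ k) (ℕₚ.≤-<-trans (ℕₚ.m∸n≤m n k) n<v))

≈[]⇒≈ : ∀ {f g} → (∀ v → f ≈[ v ] g) → f ≈ g
≈[]⇒≈ eq n = eq (suc n) n ℕₚ.≤-refl

vanishesBelow-0 : ∀ f → VanishesBelow 0 f
vanishesBelow-0 f n ()

vanishesBelow-weaken : ∀ {v w f} → w ≤ v → VanishesBelow v f → VanishesBelow w f
vanishesBelow-weaken w≤v vf n n<w = vf n (ℕₚ.<-≤-trans n<w w≤v)

vanishesBelow-cong : ∀ {v f g} → f ≈ g → VanishesBelow v f → VanishesBelow v g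
vanishesBelow-cong eq vf n n<v = trans (sym (eq n)) (vf n n<v)

vanishesBelow-scale : ∀ {v} c {f} → VanishesBelow v f → VanishesBelow v (scale c f)
vanishesBelow-scale c vf n n<v = trans (cong (c *_) (vf n n<v)) (ℤₚ.*-zeroʳ c)

vanishesBelow-X^ : ∀ k → VanishesBelow k (X^ k)
vanishesBelow-X^ (suc k) zero _ = refl
vanishesBelow-X^ (suc k) (suc n) (s≤s n<k) = vanishesBelow-X^ k n n<k

vanishesBelow-⊛ : ∀ a b {f g} → VanishesBelow a f → VanishesBelow b g → VanishesBelow (a ℕ.+ b) (f ⊛ g)
vanishesBelow-⊛ a b {f} {g} vf vg n n<a+b = sumTo-zero n term
  where
  term : ∀ k → k ≤ n → f k * g (n ∸ k) ≡ + 0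
  term k k≤n with ℕₚ.<-≤-connex k a
  ... | inj₁ k<a = cong (_* g (n ∸ k)) (vf k k<a)
  ... | inj₂ a≤k = trans (cong (f k *_) (vg (n ∸ k) n∸k<b)) (ℤₚ.*-zeroʳ (f k))
    where
    n∸k<b : n ∸ k < b
    n∸k<b = ℕₚ.+-cancelˡ-< k (n ∸ k) b (ℕₚ.≤-<-trans (ℕₚ.≤-reflexive (ℕₚ.m+[n∸m]≡n k≤n))
                                         (ℕₚ.<-≤-trans n<a+b (ℕₚ.+-monoˡ-≤ b a≤k)))

private
  module Inverse (f : Series) where
    open ≡-Reasoning

    coeffsDownFrom : ℕ → List ℤ
    coeffsDownFrom zero = inv f 0 ∷ []
    coeffsDownFrom (suc n) = inv f (suc n) ∷ coeffsDownFrom n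

    invCoeffs≡ : ∀ n → invCoeffs f n ≡ coeffsDownFrom n
    invCoeffs≡ zero = refl
    invCoeffs≡ (suc n) rewrite invCoeffs≡ n = refl

    foldr-zipWith≡sumTo : ∀ n (h : ℕ → ℤ) (φ : ℕ → ℕ) →
      foldr _+_ (+ 0) (zipWith _*_ (map h (applyUpTo φ (suc n))) (coeffsDownFrom n))
        ≡ sumTo n (λ k → h (φ k) * inv f (n ∸ k))
    foldr-zipWith≡sumTo zero h φ = ℤₚ.+-identityʳ _
    foldr-zipWith≡sumTo (suc n) h φ =
      trans (cong (_+_ (h (φ 0) * inv f (suc n))) (foldr-zipWith≡sumTo n h (φ ∘ suc)))
            (sym (sumTo-suc n (λ k → h (φ k) * inv f (suc n ∸ k))))

    tail-convolution : ℕ → ℤ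
    tail-convolution n = sumTo n (λ k → f (suc k) * inv f (n ∸ k))

    inv-suc : ∀ n → inv f (suc n) ≡ - tail-convolution n
    inv-suc n = cong -_ (trans (cong (λ cs → foldr _+_ (+ 0) (zipWith _*_ (map (λ k → f (suc k)) (upTo (suc n))) cs))
                                     (invCoeffs≡ n))
                               (foldr-zipWith≡sumTo n (λ k → f (suc k)) id))

    inverseʳ : f 0 ≡ + 1 → f ⊛ inv f ≈ 𝟙
    inverseʳ f0≡1 zero = cong (_* + 1) f0≡1
    inverseʳ f0≡1 (suc n) = begin
      sumTo (suc n) (λ k → f k * inv f (suc n ∸ k))  ≡⟨ sumTo-suc n (λ k → f k * inv f (suc n ∸ k)) ⟩
      f 0 * inv f (suc n) + tail-convolution n        ≡⟨ cong₂ (λ a b → a * b + tail-convolution n) f0≡1 (inv-suc n) ⟩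
      + 1 * - tail-convolution n + tail-convolution n ≡⟨ cong (_+ tail-convolution n) (ℤₚ.*-identityˡ (- tail-convolution n)) ⟩
      - tail-convolution n + tail-convolution n       ≡⟨ ℤₚ.+-inverseˡ (tail-convolution n) ⟩
      + 0                                             ∎

⊛-inverseʳ : ∀ f → f 0 ≡ + 1 → f ⊛ inv f ≈ 𝟙
⊛-inverseʳ f = Inverse.inverseʳ f

inverse-unique : ∀ f g h → f ⊛ g ≈ 𝟙 → f ⊛ h ≈ 𝟙 → g ≈ h
inverse-unique f g h fg≈1 fh≈1 = begin
  g              ≈⟨ ⊛-identityʳ g ⟨
  g ⊛ 𝟙          ≈⟨ ⊛-congʳ g fh≈1 ⟨
  g ⊛ (f ⊛ h)    ≈⟨ solve 3 (λ f g h → g :* (f :* h) := (f :* g) :* h) ≈-refl f g h ⟩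
  (f ⊛ g) ⊛ h    ≈⟨ ⊛-congˡ h fg≈1 ⟩
  𝟙 ⊛ h          ≈⟨ ⊛-identityˡ h ⟩
  h              ∎
  where open ≈-Reasoning

inv-cong : ∀ {f f′} → f 0 ≡ + 1 → f ≈ f′ → inv f ≈ inv f′
inv-cong {f} {f′} f0≡1 f≈f′ = inverse-unique f (inv f) (inv f′) (⊛-inverseʳ f f0≡1)
  (≈-trans (⊛-congˡ (inv f′) f≈f′) (⊛-inverseʳ f′ (trans (sym (f≈f′ 0)) f0≡1)))

inv-⊛ : ∀ f g → f 0 ≡ + 1 → g 0 ≡ + 1 → inv (f ⊛ g) ≈ inv f ⊛ inv g
inv-⊛ f g f0≡1 g0≡1 = inverse-unique (f ⊛ g) (inv (f ⊛ g)) (inv f ⊛ inv g)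
  (⊛-inverseʳ (f ⊛ g) (cong₂ _*_ f0≡1 g0≡1))
  (begin
    (f ⊛ g) ⊛ (inv f ⊛ inv g)    ≈⟨ solve 4 (λ f g f′ g′ → (f :* g) :* (f′ :* g′) := (f :* f′) :* (g :* g′)) ≈-refl f g (inv f) (inv g) ⟩
    (f ⊛ inv f) ⊛ (g ⊛ inv g)    ≈⟨ ⊛-cong (⊛-inverseʳ f f0≡1) (⊛-inverseʳ g g0≡1) ⟩
    𝟙 ⊛ 𝟙                        ≈⟨ ⊛-identityˡ 𝟙 ⟩
    𝟙                            ∎)
  where open ≈-Reasoning

⊛-inv-transpose : ∀ f {h k} → f 0 ≡ + 1 → h ⊛ f ≈ k → h ≈ k ⊛ inv f
⊛-inv-transpose f {h} {k} f0≡1 hf≈k = begin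
  h                  ≈⟨ ⊛-identityʳ h ⟨
  h ⊛ 𝟙              ≈⟨ ⊛-congʳ h (⊛-inverseʳ f f0≡1) ⟨
  h ⊛ (f ⊛ inv f)    ≈⟨ ⊛-assoc h f (inv f) ⟨
  (h ⊛ f) ⊛ inv f    ≈⟨ ⊛-congˡ (inv f) hf≈k ⟩
  k ⊛ inv f          ∎
  where open ≈-Reasoning

inv-𝟙 : inv 𝟙 ≈ 𝟙
inv-𝟙 = ≈-sym (inverse-unique 𝟙 𝟙 (inv 𝟙) (⊛-identityˡ 𝟙) (⊛-inverseʳ 𝟙 refl))

prodTo-cong : ∀ n {F G : ℕ → Series} → (∀ i → i < n → F i ≈ G i) → prodTo n F ≈ prodTo n G
prodTo-cong zero eq = ≈-refl
prodTo-cong (suc n) eq = ⊛-cong (prodTo-cong n (λ i i<n → eq i (ℕₚ.m≤n⇒m≤1+n i<n))) (eq n ℕₚ.≤-refl)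

prodTo-⊛ : ∀ n F G → prodTo n F ⊛ prodTo n G ≈ prodTo n (λ i → F i ⊛ G i)
prodTo-⊛ zero F G = ⊛-identityˡ 𝟙
prodTo-⊛ (suc n) F G = ≈-trans
  (solve 4 (λ p f q g → (p :* f) :* (q :* g) := (p :* q) :* (f :* g)) ≈-refl (prodTo n F) (F n) (prodTo n G) (G n))
  (⊛-congˡ (F n ⊛ G n) (prodTo-⊛ n F G))

prodTo-constantTerm : ∀ n F → (∀ i → F i 0 ≡ + 1) → prodTo n F 0 ≡ + 1
prodTo-constantTerm zero F _ = refl
prodTo-constantTerm (suc n) F F0≡1 = cong₂ _*_ (prodTo-constantTerm n F F0≡1) (F0≡1 n)

prodTo-extend : ∀ m e {v} F → (∀ i → m ≤ i → F i ≈[ v ] 𝟙) → prodTo (e ℕ.+ m) F ≈[ v ] prodTo m F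
prodTo-extend m zero F _ n _ = refl
prodTo-extend m (suc e) {v} F F≈1 = ≈[]-trans
  (⊛-cong-≈[] (prodTo-extend m e F F≈1) (F≈1 (e ℕ.+ m) (ℕₚ.m≤n+m m e)))
  (≈⇒≈[] v (⊛-identityʳ (prodTo m F)))

prodTo-extend-≈ : ∀ m e F → (∀ i → m ≤ i → F i ≈ 𝟙) → prodTo (e ℕ.+ m) F ≈ prodTo m F
prodTo-extend-≈ m e F F≈1 = ≈[]⇒≈ (λ v → prodTo-extend m e F (λ i m≤i → ≈⇒≈[] v (F≈1 i m≤i)))

scale-⊛-scale : ∀ a b f g → scale a f ⊛ scale b g ≈ scale (a * b) (f ⊛ g)
scale-⊛-scale a b f g n = begin
  (scale a f ⊛ scale b g) n   ≡⟨ ⊛-scaleˡ a f (scale b g) n ⟩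
  a * (f ⊛ scale b g) n       ≡⟨ cong (a *_) (⊛-scaleʳ b f g n) ⟩
  a * (b * (f ⊛ g) n)         ≡⟨ ℤₚ.*-assoc a b _ ⟨
  a * b * (f ⊛ g) n           ∎
  where open ≡-Reasoning

sumToSeries : ℕ → (ℕ → Series) → Series
sumToSeries K F n = sumTo K (λ j → F j n)

⊛-sumToSeries : ∀ f K F → f ⊛ sumToSeries K F ≈ sumToSeries K (λ j → f ⊛ F j)
⊛-sumToSeries f zero F = ≈-refl
⊛-sumToSeries f (suc K) F = ≈-trans
  (solve 3 (λ f g h → f :* (g :+ h) := f :* g :+ f :* h) ≈-refl f (sumToSeries K F) (F (suc K)))
  (⊕-cong (⊛-sumToSeries f K F) (≈-refl {f ⊛ F (suc K)}))

infSum1-truncate : ∀ F → (∀ m → VanishesBelow m (F m)) → ∀ {N K} → N ≤ K →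
  infSum1 F N ≡ sumTo K (λ j → F (suc j) N)
infSum1-truncate F vF {zero} {K} _ = sym (sumTo-zero K (λ j _ → vF (suc j) 0 (s≤s z≤n)))
infSum1-truncate F vF {suc N} {K} N<K = trans (sumTo-suc N _) (trans (ℤₚ.+-identityˡ _)
  (sym (sumTo-extend N K (λ j → F (suc j) (suc N)) (ℕₚ.<⇒≤ N<K) (λ j N<j → vF (suc j) (suc N) (s≤s N<j)))))

infSum1≈[]sumToSeries : ∀ F → (∀ m → VanishesBelow m (F m)) → ∀ N → infSum1 F ≈[ suc N ] sumToSeries N (F ∘ suc)
infSum1≈[]sumToSeries F vF N n (s≤s n≤N) = infSum1-truncate F vF n≤N

infSum1-cong : ∀ {F G} → (∀ m → F m ≈ G m) → infSum1 F ≈ infSum1 G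
infSum1-cong F≈G n = sumTo-cong n (λ { zero → refl ; (suc m) → F≈G (suc m) n })

-- The substitution q ↦ -q

sgn-+ : ∀ a b → sgn (a ℕ.+ b) ≡ sgn a * sgn b
sgn-+ zero b = sym (ℤₚ.*-identityˡ (sgn b))
sgn-+ (suc a) b = trans (cong -_ (sgn-+ a b)) (ℤₚ.neg-distribˡ-* (sgn a) (sgn b))

sgn-*-sgn : ∀ a → sgn a * sgn a ≡ + 1
sgn-*-sgn zero = refl
sgn-*-sgn (suc a) = trans (neg-*-neg (sgn a)) (sgn-*-sgn a)
  where
  neg-*-neg : ∀ i → - i * - i ≡ i * i
  neg-*-neg = solve-∀

sgn-square : ∀ m → sgn (m ℕ.* m) ≡ sgn m
sgn-square zero = refl
sgn-square (suc m) = begin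
  sgn (suc m ℕ.* suc m)                    ≡⟨ cong sgn (square-suc m) ⟩
  - sgn (m ℕ.* m ℕ.+ (m ℕ.+ m))            ≡⟨ cong -_ (sgn-+ (m ℕ.* m) (m ℕ.+ m)) ⟩
  - (sgn (m ℕ.* m) * sgn (m ℕ.+ m))        ≡⟨ cong₂ (λ a b → - (a * b)) (sgn-square m) (trans (sgn-+ m m) (sgn-*-sgn m)) ⟩
  - (sgn m * + 1)                          ≡⟨ cong -_ (ℤₚ.*-identityʳ (sgn m)) ⟩
  - sgn m                                  ∎
  where
  open ≡-Reasoning
  square-suc : ∀ m → suc m ℕ.* suc m ≡ suc (m ℕ.* m ℕ.+ (m ℕ.+ m))
  square-suc = ℕ-Solver.solve-∀

subNeg-cong : ∀ {f g} → f ≈ g → subNeg f ≈ subNeg g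
subNeg-cong eq n = cong (sgn n *_) (eq n)

subNeg-𝟙 : subNeg 𝟙 ≈ 𝟙
subNeg-𝟙 zero = refl
subNeg-𝟙 (suc n) = ℤₚ.*-zeroʳ (sgn (suc n))

subNeg-⊖ : ∀ f g → subNeg (f ⊖ g) ≈ subNeg f ⊖ subNeg g
subNeg-⊖ f g n = distrib (sgn n) (f n) (g n)
  where
  distrib : ∀ s a b → s * (a - b) ≡ s * a - s * b
  distrib = solve-∀

subNeg-⊛ : ∀ f g → subNeg (f ⊛ g) ≈ subNeg f ⊛ subNeg g
subNeg-⊛ f g n = trans (*-distribˡ-sumTo n (sgn n) (λ k → f k * g (n ∸ k))) (sumTo-cong≤ n split)
  where
  interchange : ∀ s t a b → (s * t) * (a * b) ≡ (s * a) * (t * b)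
  interchange = solve-∀
  split : ∀ k → k ≤ n → sgn n * (f k * g (n ∸ k)) ≡ sgn k * f k * (sgn (n ∸ k) * g (n ∸ k))
  split k k≤n = trans (cong (λ s → s * (f k * g (n ∸ k)))
                            (trans (cong sgn (sym (ℕₚ.m+[n∸m]≡n k≤n))) (sgn-+ k (n ∸ k))))
                      (interchange (sgn k) (sgn (n ∸ k)) (f k) (g (n ∸ k)))

subNeg-X^ : ∀ k → subNeg (X^ k) ≈ scale (sgn k) (X^ k)
subNeg-X^ k n with k ℕ.≟ n
... | yes refl = refl
... | no k≢n = trans (cong (sgn n *_) (X^-off-diag k≢n))
                     (trans (ℤₚ.*-zeroʳ (sgn n)) (sym (trans (cong (sgn k *_) (X^-off-diag k≢n)) (ℤₚ.*-zeroʳ (sgn k)))))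

subNeg-prodTo : ∀ n F → subNeg (prodTo n F) ≈ prodTo n (λ i → subNeg (F i))
subNeg-prodTo zero F = subNeg-𝟙
subNeg-prodTo (suc n) F = ≈-trans (subNeg-⊛ (prodTo n F) (F n)) (⊛-congˡ (subNeg (F n)) (subNeg-prodTo n F))

subNeg-constantTerm : ∀ f → subNeg f 0 ≡ f 0
subNeg-constantTerm f = ℤₚ.*-identityˡ (f 0)

subNeg-inv : ∀ f → f 0 ≡ + 1 → subNeg (inv f) ≈ inv (subNeg f)
subNeg-inv f f0≡1 = inverse-unique (subNeg f) (subNeg (inv f)) (inv (subNeg f))
  (≈-trans (≈-sym (subNeg-⊛ f (inv f))) (≈-trans (subNeg-cong (⊛-inverseʳ f f0≡1)) subNeg-𝟙))
  (⊛-inverseʳ (subNeg f) (trans (subNeg-constantTerm f) f0≡1))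

subNeg-scale : ∀ c f → subNeg (scale c f) ≈ scale c (subNeg f)
subNeg-scale c f n = trans (sym (ℤₚ.*-assoc (sgn n) c (f n)))
  (trans (cong (_* f n) (ℤₚ.*-comm (sgn n) c)) (ℤₚ.*-assoc c (sgn n) (f n)))

subNeg-infSum1 : ∀ F → subNeg (infSum1 F) ≈ infSum1 (subNeg ∘ F)
subNeg-infSum1 F n = trans (*-distribˡ-sumTo n (sgn n) _)
  (sumTo-cong n (λ { zero → ℤₚ.*-zeroʳ (sgn n) ; (suc m) → refl }))

-- Distinct partitions as decreasing subsets

sumOver : {A : Set} → List A → (A → ℤ) → ℤ
sumOver [] h = + 0
sumOver (x ∷ xs) h = h x + sumOver xs h

sumOver-++ : {A : Set} (xs ys : List A) (h : A → ℤ) → sumOver (xs ++ ys) h ≡ sumOver xs h + sumOver ys h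
sumOver-++ [] ys h = sym (ℤₚ.+-identityˡ _)
sumOver-++ (x ∷ xs) ys h = trans (cong (_+_ (h x)) (sumOver-++ xs ys h)) (sym (ℤₚ.+-assoc (h x) (sumOver xs h) (sumOver ys h)))

sumOver-map : {A B : Set} (f : A → B) (xs : List A) (h : B → ℤ) → sumOver (map f xs) h ≡ sumOver xs (h ∘ f)
sumOver-map f [] h = refl
sumOver-map f (x ∷ xs) h = cong (_+_ (h (f x))) (sumOver-map f xs h)

sumOver-cong∈ : {A : Set} (xs : List A) {h h′ : A → ℤ} → (∀ x → x ∈ xs → h x ≡ h′ x) → sumOver xs h ≡ sumOver xs h′
sumOver-cong∈ [] eq = refl
sumOver-cong∈ (x ∷ xs) eq = cong₂ _+_ (eq x (here refl)) (sumOver-cong∈ xs (λ y y∈xs → eq y (there y∈xs)))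

sumOver-cong : {A : Set} (xs : List A) {h h′ : A → ℤ} → (∀ x → h x ≡ h′ x) → sumOver xs h ≡ sumOver xs h′
sumOver-cong xs eq = sumOver-cong∈ xs (λ x _ → eq x)

sumOver-↭ : {A : Set} {xs ys : List A} (h : A → ℤ) → xs ↭ ys → sumOver xs h ≡ sumOver ys h
sumOver-↭ h ↭-refl = refl
sumOver-↭ h (prep x xs↭ys) = cong (_+_ (h x)) (sumOver-↭ h xs↭ys)
sumOver-↭ h (swap {xs = xs} {ys = ys} x y xs↭ys) =
  trans (swap-heads (h x) (h y) (sumOver xs h)) (cong (λ s → h y + (h x + s)) (sumOver-↭ h xs↭ys))
  where
  swap-heads : ∀ a b s → a + (b + s) ≡ b + (a + s)
  swap-heads = solve-∀
sumOver-↭ h (↭-trans xs↭ys ys↭zs) = trans (sumOver-↭ h xs↭ys) (sumOver-↭ h ys↭zs)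

sumOver-+ : {A : Set} (xs : List A) (h h′ : A → ℤ) → sumOver xs (λ x → h x + h′ x) ≡ sumOver xs h + sumOver xs h′
sumOver-+ [] h h′ = refl
sumOver-+ (x ∷ xs) h h′ = trans (cong (_+_ (h x + h′ x)) (sumOver-+ xs h h′)) (+-interchange (h x) (h′ x) (sumOver xs h) (sumOver xs h′))

*-distribˡ-sumOver : {A : Set} (xs : List A) (c : ℤ) (h : A → ℤ) → c * sumOver xs h ≡ sumOver xs (λ x → c * h x)
*-distribˡ-sumOver [] c h = ℤₚ.*-zeroʳ c
*-distribˡ-sumOver (x ∷ xs) c h = trans (ℤₚ.*-distribˡ-+ c (h x) (sumOver xs h)) (cong (_+_ (c * h x)) (*-distribˡ-sumOver xs c h))

sumOver-sumTo : {A : Set} (xs : List A) (n : ℕ) (h : A → ℕ → ℤ) →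
  sumOver xs (λ x → sumTo n (h x)) ≡ sumTo n (λ j → sumOver xs (λ x → h x j))
sumOver-sumTo [] n h = sym (sumTo-zero n (λ _ _ → refl))
sumOver-sumTo (x ∷ xs) n h =
  trans (cong (_+_ (sumTo n (h x))) (sumOver-sumTo xs n h)) (sym (sumTo-+ n (h x) (λ j → sumOver xs (λ y → h y j))))

sum-map≡sumOver : ∀ (f : List ℕ → ℕ) xs → + sum (map f xs) ≡ sumOver xs (λ x → + f x)
sum-map≡sumOver f [] = refl
sum-map≡sumOver f (x ∷ xs) = trans (ℤₚ.pos-+ (f x) (sum (map f xs))) (cong (_+_ (+ f x)) (sum-map≡sumOver f xs))

decreasingSubsets : ℕ → List (List ℕ)
decreasingSubsets zero = [] ∷ []
decreasingSubsets (suc M) = map (suc M ∷_) (decreasingSubsets M) ++ decreasingSubsets M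

IsDecreasingSubset : ℕ → List ℕ → Set
IsDecreasingSubset M π = Linked ℕ._>_ π × All (0 <_) π × All (_≤ M) π

below-head : ∀ {p ps} → Linked ℕ._>_ (p ∷ ps) → All (_< p) ps
below-head [-] = []
below-head (p>q ∷ q>qs) = p>q ∷ All.map (λ r<q → ℕₚ.<-trans r<q p>q) (below-head q>qs)

linked-∷ : ∀ {p ps} → All (_< p) ps → Linked ℕ._>_ ps → Linked ℕ._>_ (p ∷ ps)
linked-∷ {ps = []} _ _ = [-]
linked-∷ {ps = q ∷ qs} (q<p ∷ _) ps↘ = q<p ∷ ps↘

∈-decreasingSubsets⁻ : ∀ M {π} → π ∈ decreasingSubsets M → IsDecreasingSubset M π
∈-decreasingSubsets⁻ zero (here refl) = [] , [] , []
∈-decreasingSubsets⁻ (suc M) π∈ with ∈-++⁻ (map (suc M ∷_) (decreasingSubsets M)) π∈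
... | inj₁ π∈map with ∈-map⁻ (suc M ∷_) π∈map
...   | ρ , ρ∈ , refl with ∈-decreasingSubsets⁻ M ρ∈
...     | ρ↘ , ρ>0 , ρ≤M = linked-∷ (All.map s≤s ρ≤M) ρ↘ , s≤s z≤n ∷ ρ>0 , ℕₚ.≤-refl ∷ All.map ℕₚ.m≤n⇒m≤1+n ρ≤M
∈-decreasingSubsets⁻ (suc M) π∈ | inj₂ π∈rest with ∈-decreasingSubsets⁻ M π∈rest
... | π↘ , π>0 , π≤M = π↘ , π>0 , All.map ℕₚ.m≤n⇒m≤1+n π≤M

∈-decreasingSubsets⁺ : ∀ M {π} → IsDecreasingSubset M π → π ∈ decreasingSubsets M
∈-decreasingSubsets⁺ zero {[]} _ = here refl
∈-decreasingSubsets⁺ zero {p ∷ π} (_ , p>0 ∷ _ , p≤0 ∷ _) = contradiction p≤0 (ℕₚ.<⇒≱ p>0)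
∈-decreasingSubsets⁺ (suc M) {[]} _ =
  ∈-++⁺ʳ (map (suc M ∷_) (decreasingSubsets M)) (∈-decreasingSubsets⁺ M ([] , [] , []))
∈-decreasingSubsets⁺ (suc M) {p ∷ π} (p∷π↘ , p>0 ∷ π>0 , p≤1+M ∷ _) with p ℕ.≟ suc M
... | yes refl = ∈-++⁺ˡ (∈-map⁺ (suc M ∷_)
      (∈-decreasingSubsets⁺ M (Linked.tail p∷π↘ , π>0 , All.map ℕₚ.≤-pred (below-head p∷π↘))))
... | no p≢1+M = ∈-++⁺ʳ (map (suc M ∷_) (decreasingSubsets M))
      (∈-decreasingSubsets⁺ M (p∷π↘ , p>0 ∷ π>0 , p≤M ∷ All.map (λ q<p → ℕₚ.≤-trans (ℕₚ.<⇒≤ q<p) p≤M) (below-head p∷π↘)))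
  where
  p≤M : p ≤ M
  p≤M = ℕₚ.≤-pred (ℕₚ.≤∧≢⇒< p≤1+M p≢1+M)

decreasingSubsets-unique : ∀ M → Unique (decreasingSubsets M)
decreasingSubsets-unique zero = [] ∷ []
decreasingSubsets-unique (suc M) =
  Uniqueₚ.++⁺ (Uniqueₚ.map⁺ ∷-injectiveʳ (decreasingSubsets-unique M)) (decreasingSubsets-unique M) disjoint
  where
  disjoint : ∀ {π} → ¬ (π ∈ map (suc M ∷_) (decreasingSubsets M) × π ∈ decreasingSubsets M)
  disjoint (π∈map , π∈rest) with ∈-map⁻ (suc M ∷_) π∈map
  ... | _ , _ , refl with ∈-decreasingSubsets⁻ M π∈rest
  ...   | _ , _ , 1+M≤M ∷ _ = ℕₚ.<-irrefl refl 1+M≤M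

∈⇒≤sum : ∀ {x} (π : List ℕ) → x ∈ π → x ≤ sum π
∈⇒≤sum (p ∷ π) (here refl) = ℕₚ.m≤m+n p (sum π)
∈⇒≤sum (p ∷ π) (there x∈π) = ℕₚ.≤-trans (∈⇒≤sum π x∈π) (ℕₚ.m≤n+m (sum π) p)

length≤sum : (π : List ℕ) → All (0 <_) π → length π ≤ sum π
length≤sum [] _ = z≤n
length≤sum (p ∷ π) (p>0 ∷ π>0) = ℕₚ.+-mono-≤ p>0 (length≤sum π π>0)

sumOver-filter-sum≡ : ∀ N (πs : List (List ℕ)) (h : List ℕ → ℤ) →
  sumOver (filter (λ π → sum π ℕ.≟ N) πs) h ≡ sumOver πs (λ π → h π * (X^ sum π) N)
sumOver-filter-sum≡ N [] h = refl
sumOver-filter-sum≡ N (π ∷ πs) h with sum π ℕ.≟ N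
... | yes sum≡N = begin
  sumOver (filter (λ π → sum π ℕ.≟ N) (π ∷ πs)) h
    ≡⟨ cong (λ ρs → sumOver ρs h) (filter-accept (λ π → sum π ℕ.≟ N) {π} {πs} sum≡N) ⟩
  h π + sumOver (filter (λ π → sum π ℕ.≟ N) πs) h
    ≡⟨ cong₂ _+_ (sym (ℤₚ.*-identityʳ (h π))) (sumOver-filter-sum≡ N πs h) ⟩
  h π * + 1 + sumOver πs (λ π → h π * (X^ sum π) N)
    ≡⟨ cong (λ m → h π * m + _) (subst (λ n → (X^ sum π) n ≡ + 1) sum≡N (X^-diag (sum π))) ⟨
  h π * (X^ sum π) N + sumOver πs (λ π → h π * (X^ sum π) N) ∎
  where open ≡-Reasoning
... | no sum≢N = begin
  sumOver (filter (λ π → sum π ℕ.≟ N) (π ∷ πs)) h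
    ≡⟨ cong (λ ρs → sumOver ρs h) (filter-reject (λ π → sum π ℕ.≟ N) {π} {πs} sum≢N) ⟩
  sumOver (filter (λ π → sum π ℕ.≟ N) πs) h
    ≡⟨ sumOver-filter-sum≡ N πs h ⟩
  sumOver πs (λ π → h π * (X^ sum π) N)
    ≡⟨ ℤₚ.+-identityˡ _ ⟨
  + 0 + sumOver πs (λ π → h π * (X^ sum π) N)
    ≡⟨ cong (_+ _) (trans (cong (h π *_) (X^-off-diag sum≢N)) (ℤₚ.*-zeroʳ (h π))) ⟨
  h π * (X^ sum π) N + sumOver πs (λ π → h π * (X^ sum π) N) ∎
  where open ≡-Reasoning

sumOverSeries : {A : Set} → List A → (A → Series) → Series
sumOverSeries xs F n = sumOver xs (λ x → F x n)

subsetGF : ℕ → (List ℕ → ℤ) → Series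
subsetGF M w = sumOverSeries (decreasingSubsets M) (λ π → scale (w π) (X^ sum π))

sumOverSeries-cong∈ : {A : Set} (xs : List A) {F G : A → Series} →
  (∀ x → x ∈ xs → F x ≈ G x) → sumOverSeries xs F ≈ sumOverSeries xs G
sumOverSeries-cong∈ xs eq n = sumOver-cong∈ xs (λ x x∈xs → eq x x∈xs n)

⊛-sumOverSeries : {A : Set} (f : Series) (xs : List A) (F : A → Series) →
  f ⊛ sumOverSeries xs F ≈ sumOverSeries xs (λ x → f ⊛ F x)
⊛-sumOverSeries f [] F = ≈-trans (⊛-comm f 𝟘) (⊛-zeroˡ f)
⊛-sumOverSeries f (x ∷ xs) F = ≈-trans
  (solve 3 (λ f g h → f :* (g :+ h) := f :* g :+ f :* h) ≈-refl f (F x) (sumOverSeries xs F))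
  (⊕-cong (≈-refl {f ⊛ F x}) (⊛-sumOverSeries f xs F))

subsetGF-cong : ∀ M {w w′} → (∀ π → w π ≡ w′ π) → subsetGF M w ≈ subsetGF M w′
subsetGF-cong M eq n = sumOver-cong (decreasingSubsets M) (λ π → cong (_* (X^ sum π) n) (eq π))

hasPart : ℕ → List ℕ → Bool
hasPart p π = does (p ∈? π)

indicator : Bool → ℤ
indicator true = + 1
indicator false = + 0

weight : (ℕ → Bool → ℤ) → ℕ → List ℕ → ℤ
weight ψ zero π = + 1
weight ψ (suc M) π = weight ψ M π * ψ M (hasPart (suc M) π)

partFactor : (ℕ → Bool → ℤ) → ℕ → Series
partFactor ψ i = scale (ψ i false) 𝟙 ⊕ scale (ψ i true) (X^ suc i)

hasPart-head : ∀ p π → hasPart p (p ∷ π) ≡ true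
hasPart-head p π = dec-true (p ∈? (p ∷ π)) (here refl)

hasPart-above : ∀ {p π} → All (_< p) π → hasPart p π ≡ false
hasPart-above π<p = dec-false (_ ∈? _) (λ p∈π → ℕₚ.<-irrefl refl (All.lookup π<p p∈π))

hasPart-∷-< : ∀ {p x} π → p < x → hasPart p (x ∷ π) ≡ hasPart p π
hasPart-∷-< {p} {x} π p<x = agree (p ∈? π)
  where
  agree : (p∈?π : Dec (p ∈ π)) → hasPart p (x ∷ π) ≡ does p∈?π
  agree (yes p∈π) = dec-true (p ∈? (x ∷ π)) (there p∈π)
  agree (no p∉π) = dec-false (p ∈? (x ∷ π)) λ where
    (here refl) → ℕₚ.<-irrefl refl p<x
    (there p∈π) → p∉π p∈π

weight-∷ : ∀ ψ M {x} π → M < x → weight ψ M (x ∷ π) ≡ weight ψ M π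
weight-∷ ψ zero π _ = refl
weight-∷ ψ (suc M) π M<x =
  cong₂ _*_ (weight-∷ ψ M π (ℕₚ.<-trans (ℕₚ.n<1+n M) M<x)) (cong (ψ M) (hasPart-∷-< π M<x))

subsetGF-weight : ∀ ψ M → subsetGF M (weight ψ M) ≈ prodTo M (partFactor ψ)
subsetGF-weight ψ zero zero = refl
subsetGF-weight ψ zero (suc N) = refl
subsetGF-weight ψ (suc M) = begin
  subsetGF (suc M) (weight ψ (suc M))
    ≈⟨ split ⟩
  sumOverSeries S (λ π → scale (weight ψ (suc M) (suc M ∷ π)) (X^ sum (suc M ∷ π))) ⊕ sumOverSeries S (λ π → term π)
    ≈⟨ ⊕-cong (sumOverSeries-cong∈ S with-top) (sumOverSeries-cong∈ S without-top) ⟩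
  sumOverSeries S (λ π → top ⊛ term′ π) ⊕ sumOverSeries S (λ π → rest ⊛ term′ π)
    ≈⟨ ⊕-cong (⊛-sumOverSeries top S term′) (⊛-sumOverSeries rest S term′) ⟨
  (top ⊛ subsetGF M w) ⊕ (rest ⊛ subsetGF M w)
    ≈⟨ solve 3 (λ t r g → t :* g :+ r :* g := g :* (r :+ t)) ≈-refl top rest (subsetGF M w) ⟩
  subsetGF M w ⊛ partFactor ψ M
    ≈⟨ ⊛-congˡ (partFactor ψ M) (subsetGF-weight ψ M) ⟩
  prodTo (suc M) (partFactor ψ) ∎
  where
  open ≈-Reasoning
  S = decreasingSubsets M
  w = weight ψ M
  top = scale (ψ M true) (X^ suc M)
  rest = scale (ψ M false) 𝟙
  term : List ℕ → Series
  term π = scale (weight ψ (suc M) π) (X^ sum π)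
  term′ : List ℕ → Series
  term′ π = scale (w π) (X^ sum π)
  split : subsetGF (suc M) (weight ψ (suc M)) ≈
          (sumOverSeries S (λ π → term (suc M ∷ π)) ⊕ sumOverSeries S term)
  split n = trans (sumOver-++ (map (suc M ∷_) S) S (λ π → term π n))
                  (cong (_+ sumOverSeries S term n) (sumOver-map (suc M ∷_) S (λ π → term π n)))
  parts<1+M : ∀ {π} → π ∈ S → All (_< suc M) π
  parts<1+M π∈S with ∈-decreasingSubsets⁻ M π∈S
  ... | _ , _ , π≤M = All.map s≤s π≤M
  with-top : ∀ π → π ∈ S → term (suc M ∷ π) ≈ top ⊛ term′ π
  with-top π π∈S = ≈-sym (begin
    scale (ψ M true) (X^ suc M) ⊛ scale (w π) (X^ sum π)  ≈⟨ scale-⊛-scale (ψ M true) (w π) (X^ suc M) (X^ sum π) ⟩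
    scale (ψ M true * w π) ((X^ suc M) ⊛ (X^ sum π))      ≈⟨ scale-cong (ψ M true * w π) (X^-+ (suc M) (sum π)) ⟩
    scale (ψ M true * w π) (X^ sum (suc M ∷ π))           ≡⟨ cong (λ c → scale c (X^ sum (suc M ∷ π))) weight-top ⟩
    term (suc M ∷ π)                                      ∎)
    where
    weight-top : ψ M true * w π ≡ weight ψ (suc M) (suc M ∷ π)
    weight-top = trans (ℤₚ.*-comm (ψ M true) (w π))
      (sym (cong₂ (λ a b → a * ψ M b) (weight-∷ ψ M π (ℕₚ.n<1+n M)) (hasPart-head (suc M) π)))
  without-top : ∀ π → π ∈ S → term π ≈ rest ⊛ term′ π
  without-top π π∈S = ≈-sym (begin
    scale (ψ M false) 𝟙 ⊛ scale (w π) (X^ sum π)  ≈⟨ scale-⊛-scale (ψ M false) (w π) 𝟙 (X^ sum π) ⟩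
    scale (ψ M false * w π) (𝟙 ⊛ (X^ sum π))      ≈⟨ scale-cong (ψ M false * w π) (⊛-identityˡ (X^ sum π)) ⟩
    scale (ψ M false * w π) (X^ sum π)            ≡⟨ cong (λ c → scale c (X^ sum π)) weight-rest ⟩
    term π                                        ∎)
    where
    weight-rest : ψ M false * w π ≡ weight ψ (suc M) π
    weight-rest = trans (ℤₚ.*-comm (ψ M false) (w π))
      (cong (λ b → w π * ψ M b) (sym (hasPart-above (parts<1+M π∈S))))

-- Runs of odd parts

runIndicator : List ℕ → ℕ → ℕ → ℤ
runIndicator π c zero = + 1
runIndicator π c (suc j) = indicator (hasPart c π) * runIndicator π (2 ℕ.+ c) j

RunIn : List ℕ → ℕ → ℕ → Set
RunIn π c j = ∀ i → i < j → c ℕ.+ 2 ℕ.* i ∈ π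

private
  2+c+2*i≡c+2*[1+i] : ∀ c i → 2 ℕ.+ c ℕ.+ 2 ℕ.* i ≡ c ℕ.+ 2 ℕ.* suc i
  2+c+2*i≡c+2*[1+i] = ℕ-Solver.solve-∀

runIndicator-suc : ∀ π c j → runIndicator π c (suc j) ≡ runIndicator π c j * indicator (hasPart (c ℕ.+ 2 ℕ.* j) π)
runIndicator-suc π c zero =
  trans (ℤₚ.*-comm (indicator (hasPart c π)) (+ 1)) (cong (λ m → + 1 * indicator (hasPart m π)) (sym (ℕₚ.+-identityʳ c)))
runIndicator-suc π c (suc j) = begin
  indicator (hasPart c π) * runIndicator π (2 ℕ.+ c) (suc j)
    ≡⟨ cong (indicator (hasPart c π) *_) (runIndicator-suc π (2 ℕ.+ c) j) ⟩
  indicator (hasPart c π) * (runIndicator π (2 ℕ.+ c) j * indicator (hasPart (2 ℕ.+ c ℕ.+ 2 ℕ.* j) π))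
    ≡⟨ ℤₚ.*-assoc (indicator (hasPart c π)) _ _ ⟨
  runIndicator π c (suc j) * indicator (hasPart (2 ℕ.+ c ℕ.+ 2 ℕ.* j) π)
    ≡⟨ cong (λ m → runIndicator π c (suc j) * indicator (hasPart m π)) (2+c+2*i≡c+2*[1+i] c j) ⟩
  runIndicator π c (suc j) * indicator (hasPart (c ℕ.+ 2 ℕ.* suc j) π) ∎
  where open ≡-Reasoning

runIndicator≡0⊎RunIn : ∀ π c j → runIndicator π c j ≡ + 0 ⊎ RunIn π c j
runIndicator≡0⊎RunIn π c zero = inj₂ (λ i ())
runIndicator≡0⊎RunIn π c (suc j) with c ∈? π | runIndicator≡0⊎RunIn π (2 ℕ.+ c) j
... | no _ | _ = inj₁ refl
... | yes _ | inj₁ run≡0 = inj₁ (trans (ℤₚ.*-identityˡ _) run≡0)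
... | yes c∈π | inj₂ run = inj₂ λ where
  zero _ → subst (_∈ π) (sym (ℕₚ.+-identityʳ c)) c∈π
  (suc i) (s≤s i<j) → subst (_∈ π) (2+c+2*i≡c+2*[1+i] c i) (run i i<j)

RunIn⇒≤length : ∀ π c j → Linked ℕ._>_ π → RunIn π c j → j ≤ length π
RunIn⇒≤length π c zero _ _ = z≤n
RunIn⇒≤length [] c (suc j) _ run with run 0 (s≤s z≤n)
... | ()
RunIn⇒≤length (p ∷ ps) c (suc j) p∷ps↘ run = s≤s (RunIn⇒≤length ps c j (Linked.tail p∷ps↘) run-in-tail)
  where
  last≤p : c ℕ.+ 2 ℕ.* j ≤ p
  last≤p with run j ℕₚ.≤-refl
  ... | here last≡p = ℕₚ.≤-reflexive last≡p
  ... | there last∈ps = ℕₚ.<⇒≤ (All.lookup (below-head p∷ps↘) last∈ps)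
  run-in-tail : RunIn ps c j
  run-in-tail i i<j with run i (ℕₚ.m≤n⇒m≤1+n i<j)
  ... | here e = contradiction e (ℕₚ.<⇒≢ (ℕₚ.<-≤-trans (ℕₚ.+-monoʳ-< c (ℕₚ.*-monoʳ-< 2 i<j)) last≤p))
  ... | there x∈ps = x∈ps

private
  sumBelow : ℕ → (ℕ → ℤ) → ℤ
  sumBelow zero h = + 0
  sumBelow (suc f) h = h 0 + sumBelow f (h ∘ suc)

  sumBelow-cong : ∀ f {h h′ : ℕ → ℤ} → (∀ j → h j ≡ h′ j) → sumBelow f h ≡ sumBelow f h′
  sumBelow-cong zero _ = refl
  sumBelow-cong (suc f) eq = cong₂ _+_ (eq 0) (sumBelow-cong f (eq ∘ suc))

  sumBelow-suc≡sumTo : ∀ K (h : ℕ → ℤ) → sumBelow (suc K) h ≡ sumTo K h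
  sumBelow-suc≡sumTo zero h = ℤₚ.+-identityʳ (h 0)
  sumBelow-suc≡sumTo (suc K) h = trans (cong (_+_ (h 0)) (sumBelow-suc≡sumTo K (h ∘ suc))) (sym (sumTo-suc K h))

  moexAux-present : ∀ π f c → c ∈ π → moexAux π (suc f) c ≡ moexAux π f (2 ℕ.+ c)
  moexAux-present π f c c∈π with c ∈? π
  ... | yes _ = refl
  ... | no c∉π = contradiction c∈π c∉π

  moexAux-absent : ∀ π f c → ¬ (c ∈ π) → moexAux π (suc f) c ≡ c
  moexAux-absent π f c c∉π with c ∈? π
  ... | yes c∈π = contradiction c∈π c∉π
  ... | no _ = refl

  moexAux-expansion : ∀ π f c → + moexAux π f c ≡ + c + + 2 * sumBelow f (λ j → runIndicator π c (suc j))
  moexAux-expansion π zero c = sym (ℤₚ.+-identityʳ (+ c))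
  moexAux-expansion π (suc f) c = by-cases (c ∈? π)
    where
    2+c+2*s≡c+2*[1+s] : ∀ c s → + 2 + c + + 2 * s ≡ c + + 2 * (+ 1 + s)
    2+c+2*s≡c+2*[1+s] = solve-∀
    by-cases : Dec (c ∈ π) → + moexAux π (suc f) c ≡ + c + + 2 * sumBelow (suc f) (λ j → runIndicator π c (suc j))
    by-cases (yes c∈π) rewrite moexAux-present π f c c∈π | dec-true (c ∈? π) c∈π = begin
      + moexAux π f (2 ℕ.+ c)                           ≡⟨ moexAux-expansion π f (2 ℕ.+ c) ⟩
      + 2 + + c + + 2 * rest                            ≡⟨ 2+c+2*s≡c+2*[1+s] (+ c) rest ⟩
      + c + + 2 * (+ 1 + rest)                          ≡⟨ cong (λ s → + c + + 2 * (+ 1 + s)) (sumBelow-cong f (λ j → sym (ℤₚ.*-identityˡ (runIndicator π (2 ℕ.+ c) (suc j))))) ⟩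
      + c + + 2 * (+ 1 + sumBelow f (λ j → + 1 * runIndicator π (2 ℕ.+ c) (suc j))) ∎
      where
      open ≡-Reasoning
      rest = sumBelow f (λ j → runIndicator π (2 ℕ.+ c) (suc j))
    by-cases (no c∉π) rewrite moexAux-absent π f c c∉π | dec-false (c ∈? π) c∉π = begin
      + c                      ≡⟨ ℤₚ.+-identityʳ (+ c) ⟨
      + c + + 0                ≡⟨ cong (λ s → + c + + 2 * s) (sumBelow-zero (suc f) {runIndicator π (2 ℕ.+ c)}) ⟨
      + c + + 2 * sumBelow (suc f) (λ j → + 0 * runIndicator π (2 ℕ.+ c) j) ∎
      where
      open ≡-Reasoning
      sumBelow-zero : ∀ f {h : ℕ → ℤ} → sumBelow f (λ j → + 0 * h j) ≡ + 0
      sumBelow-zero zero = refl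
      sumBelow-zero (suc f) {h} = trans (ℤₚ.+-identityˡ _) (sumBelow-zero f {h ∘ suc})

moex-expansion : ∀ π K → Linked ℕ._>_ π → length π ≤ K →
  + moex π ≡ + 1 + + 2 * sumTo K (λ j → runIndicator π 1 (suc j))
moex-expansion π K π↘ length≤K = trans (moexAux-expansion π (suc (length π)) 1)
  (cong (λ s → + 1 + + 2 * s) (trans (sumBelow-suc≡sumTo (length π) _) (sym (sumTo-extend (length π) K _ length≤K long-runs-vanish))))
  where
  long-runs-vanish : ∀ j → length π < j → runIndicator π 1 (suc j) ≡ + 0
  long-runs-vanish j length<j with runIndicator≡0⊎RunIn π 1 (suc j)
  ... | inj₁ run≡0 = run≡0
  ... | inj₂ run = contradiction (RunIn⇒≤length π 1 (suc j) π↘ run) (ℕₚ.<⇒≱ (s≤s (ℕₚ.<⇒≤ length<j)))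

double : ℕ → ℕ
double zero = zero
double (suc t) = suc (suc (double t))

double≡2* : ∀ t → double t ≡ 2 ℕ.* t
double≡2* zero = refl
double≡2* (suc t) = trans (cong (suc ∘ suc) (double≡2* t)) (sym (ℕₚ.*-suc 2 t))

double-mono : ∀ {s t} → s ≤ t → double s ≤ double t
double-mono z≤n = z≤n
double-mono (s≤s s≤t) = s≤s (s≤s (double-mono s≤t))

sgn-double : ∀ t → sgn (double t) ≡ + 1
sgn-double zero = refl
sgn-double (suc t) = trans (ℤₚ.neg-involutive (sgn (double t))) (sgn-double t)

-- inOddRun j i holds when the part i + 1 is one of 1, 3, …, 2j + 1.
inOddRun : ℕ → ℕ → Bool
inOddRun j zero = true
inOddRun j (suc zero) = false
inOddRun zero (suc (suc i)) = false
inOddRun (suc j) (suc (suc i)) = inOddRun j i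

inOddRun-double : ∀ {j t} → t ≤ j → inOddRun j (double t) ≡ true
inOddRun-double {t = zero} _ = refl
inOddRun-double {suc j} {suc t} (s≤s t≤j) = inOddRun-double t≤j

inOddRun-odd : ∀ j t → inOddRun j (suc (double t)) ≡ false
inOddRun-odd j zero = refl
inOddRun-odd zero (suc t) = refl
inOddRun-odd (suc j) (suc t) = inOddRun-odd j t

inOddRun-beyond : ∀ j {i} → double j < i → inOddRun j i ≡ false
inOddRun-beyond zero {suc zero} _ = refl
inOddRun-beyond zero {suc (suc i)} _ = refl
inOddRun-beyond (suc j) {suc (suc i)} (s≤s (s≤s 2j<i)) = inOddRun-beyond j 2j<i

runWeight : ℕ → ℕ → Bool → ℤ
runWeight j i b = if inOddRun j i then indicator b else + 1

weight-runWeight-double : ∀ π j t → t ≤ suc j → weight (runWeight j) (double t) π ≡ runIndicator π 1 t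
weight-runWeight-double π j zero _ = refl
weight-runWeight-double π j (suc t) (s≤s t≤j) = begin
  weight (runWeight j) (double t) π * runWeight j (double t) (hasPart (suc (double t)) π)
    * runWeight j (suc (double t)) (hasPart (suc (suc (double t))) π)
    ≡⟨ cong₂ (λ a b → weight (runWeight j) (double t) π * a * b) odd-part-counted even-part-ignored ⟩
  weight (runWeight j) (double t) π * indicator (hasPart (suc (double t)) π) * + 1
    ≡⟨ ℤₚ.*-identityʳ _ ⟩
  weight (runWeight j) (double t) π * indicator (hasPart (suc (double t)) π)
    ≡⟨ cong₂ (λ a m → a * indicator (hasPart (suc m) π)) (weight-runWeight-double π j t (ℕₚ.m≤n⇒m≤1+n t≤j)) (double≡2* t) ⟩
  runIndicator π 1 t * indicator (hasPart (1 ℕ.+ 2 ℕ.* t) π)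
    ≡⟨ runIndicator-suc π 1 t ⟨
  runIndicator π 1 (suc t) ∎
  where
  open ≡-Reasoning
  odd-part-counted : runWeight j (double t) (hasPart (suc (double t)) π) ≡ indicator (hasPart (suc (double t)) π)
  odd-part-counted rewrite inOddRun-double t≤j = refl
  even-part-ignored : runWeight j (suc (double t)) (hasPart (suc (suc (double t))) π) ≡ + 1
  even-part-ignored rewrite inOddRun-odd j t = refl

weight-runWeight-beyond : ∀ π j e → weight (runWeight j) (e ℕ.+ double (suc j)) π ≡ weight (runWeight j) (double (suc j)) π
weight-runWeight-beyond π j zero = refl
weight-runWeight-beyond π j (suc e) =
  trans (cong (weight (runWeight j) (e ℕ.+ double (suc j)) π *_) part-ignored)
        (trans (ℤₚ.*-identityʳ _) (weight-runWeight-beyond π j e))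
  where
  part-ignored : runWeight j (e ℕ.+ double (suc j)) (hasPart (suc (e ℕ.+ double (suc j))) π) ≡ + 1
  part-ignored rewrite inOddRun-beyond j {e ℕ.+ double (suc j)}
    (ℕₚ.<-≤-trans (ℕₚ.n<1+n (double j)) (ℕₚ.≤-trans (ℕₚ.n≤1+n (suc (double j))) (ℕₚ.m≤n+m (double (suc j)) e))) = refl

runIndicator≡weight : ∀ π j e → runIndicator π 1 (suc j) ≡ weight (runWeight j) (e ℕ.+ double (suc j)) π
runIndicator≡weight π j e = sym (trans (weight-runWeight-beyond π j e) (weight-runWeight-double π j (suc j) ℕₚ.≤-refl))

distinctFactor : ℕ → Series
distinctFactor i = 𝟙 ⊕ (X^ suc i)

oddFactor : ℕ → Series
oddFactor t = distinctFactor (double t)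

prodTo-double : ∀ F → (∀ t → F (suc (double t)) ≈ 𝟙) → ∀ t → prodTo (double t) F ≈ prodTo t (F ∘ double)
prodTo-double F odd≈1 zero = ≈-refl
prodTo-double F odd≈1 (suc t) = begin
  (prodTo (double t) F ⊛ F (double t)) ⊛ F (suc (double t))  ≈⟨ ⊛-congʳ (prodTo (double t) F ⊛ F (double t)) (odd≈1 t) ⟩
  (prodTo (double t) F ⊛ F (double t)) ⊛ 𝟙                  ≈⟨ ⊛-identityʳ _ ⟩
  prodTo (double t) F ⊛ F (double t)                         ≈⟨ ⊛-congˡ (F (double t)) (prodTo-double F odd≈1 t) ⟩
  prodTo t (F ∘ double) ⊛ F (double t)                        ∎
  where open ≈-Reasoning

prodTo-oddRun : ∀ j F → (∀ i → inOddRun j i ≡ false → F i ≈ 𝟙) →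
  ∀ e → prodTo (e ℕ.+ double (suc j)) F ≈ prodTo (suc j) (F ∘ double)
prodTo-oddRun j F trivial e = ≈-trans
  (prodTo-extend-≈ (double (suc j)) e F (λ i 2j+2≤i → trivial i (inOddRun-beyond j (ℕₚ.<-trans (ℕₚ.n<1+n (double j)) 2j+2≤i))))
  (prodTo-double F (λ t → trivial (suc (double t)) (inOddRun-odd j t)) (suc j))

prodTo-X^-odd : ∀ t → prodTo t (λ s → X^ suc (double s)) ≈ X^ (t ℕ.* t)
prodTo-X^-odd zero = ≈-refl
prodTo-X^-odd (suc t) = ≈-trans (⊛-congˡ (X^ suc (double t)) (prodTo-X^-odd t))
  (≈-trans (X^-+ (t ℕ.* t) (suc (double t))) (X^-cong (trans (cong (λ m → t ℕ.* t ℕ.+ suc m) (double≡2* t)) (square-step t))))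
  where
  square-step : ∀ t → t ℕ.* t ℕ.+ suc (2 ℕ.* t) ≡ suc t ℕ.* suc t
  square-step = ℕ-Solver.solve-∀

partFactor-runWeight : ∀ j i → partFactor (runWeight j) i ≈ (if inOddRun j i then X^ suc i else distinctFactor i)
partFactor-runWeight j i with inOddRun j i
... | true = λ n → trans (cong (_+ + 1 * (X^ suc i) n) (ℤₚ.*-zeroˡ (𝟙 n))) (trans (ℤₚ.+-identityˡ _) (ℤₚ.*-identityˡ _))
... | false = λ n → cong₂ _+_ (ℤₚ.*-identityˡ (𝟙 n)) (ℤₚ.*-identityˡ ((X^ suc i) n))

factor-completion : ∀ b i → (if b then X^ suc i else distinctFactor i) ⊛ (if b then distinctFactor i else 𝟙)
                          ≈ (X^ (if b then suc i else 0)) ⊛ distinctFactor i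
factor-completion true i = ≈-refl
factor-completion false i = ≈-trans (⊛-identityʳ (distinctFactor i)) (≈-sym (⊛-identityˡ (distinctFactor i)))

-- Forcing the parts 1, 3, …, 2j + 1 turns their factors 1 + q^(2t+1) into q^(2t+1); multiplying the
-- lost factors back in gives q^(1 + 3 + … + (2j+1)) = q^((j+1)²).
runFactors : ∀ j e → let M = e ℕ.+ double (suc j) in
  prodTo M (partFactor (runWeight j)) ⊛ prodTo (suc j) oddFactor ≈ (X^ (suc j ℕ.* suc j)) ⊛ prodTo M distinctFactor
runFactors j e = begin
  prodTo M (partFactor (runWeight j)) ⊛ prodTo (suc j) oddFactor
    ≈⟨ ⊛-congʳ (prodTo M (partFactor (runWeight j)))
         (≈-trans (prodTo-oddRun j missing missing-trivial e) (prodTo-cong (suc j) (λ t t<1+j → missing-selected t (ℕₚ.≤-pred t<1+j)))) ⟨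
  prodTo M (partFactor (runWeight j)) ⊛ prodTo M missing
    ≈⟨ prodTo-⊛ M (partFactor (runWeight j)) missing ⟩
  prodTo M (λ i → partFactor (runWeight j) i ⊛ missing i)
    ≈⟨ prodTo-cong M (λ i _ → ≈-trans (⊛-congˡ (missing i) (partFactor-runWeight j i)) (factor-completion (inOddRun j i) i)) ⟩
  prodTo M (λ i → (X^ gap i) ⊛ distinctFactor i)
    ≈⟨ prodTo-⊛ M (λ i → X^ gap i) distinctFactor ⟨
  prodTo M (λ i → X^ gap i) ⊛ prodTo M distinctFactor
    ≈⟨ ⊛-congˡ (prodTo M distinctFactor) (begin
         prodTo M (λ i → X^ gap i)                         ≈⟨ prodTo-oddRun j (λ i → X^ gap i) gap-trivial e ⟩
         prodTo (suc j) (λ t → X^ gap (double t))          ≈⟨ prodTo-cong (suc j) (λ t t<1+j → gap-selected t (ℕₚ.≤-pred t<1+j)) ⟩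
         prodTo (suc j) (λ t → X^ suc (double t))          ≈⟨ prodTo-X^-odd (suc j) ⟩
         X^ (suc j ℕ.* suc j)                              ∎) ⟩
  (X^ (suc j ℕ.* suc j)) ⊛ prodTo M distinctFactor ∎
  where
  open ≈-Reasoning
  M = e ℕ.+ double (suc j)
  missing : ℕ → Series
  missing i = if inOddRun j i then distinctFactor i else 𝟙
  gap : ℕ → ℕ
  gap i = if inOddRun j i then suc i else 0
  missing-trivial : ∀ i → inOddRun j i ≡ false → missing i ≈ 𝟙
  missing-trivial i unselected rewrite unselected = ≈-refl
  gap-trivial : ∀ i → inOddRun j i ≡ false → X^ gap i ≈ 𝟙
  gap-trivial i unselected rewrite unselected = ≈-refl
  missing-selected : ∀ t → t ≤ j → missing (double t) ≈ oddFactor t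
  missing-selected t t≤j rewrite inOddRun-double t≤j = ≈-refl
  gap-selected : ∀ t → t ≤ j → X^ gap (double t) ≈ X^ suc (double t)
  gap-selected t t≤j rewrite inOddRun-double t≤j = ≈-refl

-- The generating function of moex over distinct partitions

𝟙⊖minusQ⊛ : ∀ g k → g ≈ X^ k → 𝟙 ⊖ (minusQ ⊛ g) ≈ distinctFactor k
𝟙⊖minusQ⊛ g k g≈X^k n = begin
  𝟙 n - (minusQ ⊛ g) n       ≡⟨ cong (_-_ (𝟙 n)) (⊛-scaleˡ (- + 1) X g n) ⟩
  𝟙 n - (- + 1 * (X ⊛ g) n)  ≡⟨ cancel (𝟙 n) ((X ⊛ g) n) ⟩
  𝟙 n + (X ⊛ g) n            ≡⟨ cong (_+_ (𝟙 n)) (⊛-cong X≈X^1 g≈X^k n) ⟩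
  𝟙 n + ((X^ 1) ⊛ (X^ k)) n  ≡⟨ cong (_+_ (𝟙 n)) (X^-+ 1 k n) ⟩
  𝟙 n + (X^ suc k) n         ∎
  where
  open ≡-Reasoning
  cancel : ∀ a b → a - (- + 1 * b) ≡ a + b
  cancel = solve-∀

pow-X² : ∀ t → pow (pow X 2) t ≈ X^ double t
pow-X² t = ≈-trans (pow-cong t (pow-X 2)) (≈-trans (pow-X^ 2 t) (X^-cong (sym (double≡2* t))))

X⊛pow-X² : ∀ t → X ⊛ pow (pow X 2) t ≈ X^ suc (double t)
X⊛pow-X² t = ≈-trans (⊛-cong X≈X^1 (pow-X² t)) (X^-+ 1 (double t))

poch[-q,q]≈ : ∀ n → poch minusQ X n ≈ prodTo n distinctFactor
poch[-q,q]≈ n = prodTo-cong n (λ j _ → 𝟙⊖minusQ⊛ (pow X j) j (pow-X j))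

poch[-q,q²]≈ : ∀ n → poch minusQ (pow X 2) n ≈ prodTo n oddFactor
poch[-q,q²]≈ n = prodTo-cong n (λ t _ → 𝟙⊖minusQ⊛ (pow (pow X 2) t) (double t) (pow-X² t))

prodTo-oddFactor-constantTerm : ∀ t → prodTo t oddFactor 0 ≡ + 1
prodTo-oddFactor-constantTerm t = prodTo-constantTerm t oddFactor (λ _ → refl)

pochInf[-q,q]≡prodTo : ∀ {N M} → N < M → pochInf minusQ X N ≡ prodTo M distinctFactor N
pochInf[-q,q]≡prodTo {N} {M} N<M = begin
  poch minusQ X (suc N) N                        ≡⟨ poch[-q,q]≈ (suc N) N ⟩
  prodTo (suc N) distinctFactor N                ≡⟨ prodTo-extend (suc N) (M ∸ suc N) distinctFactor high-factors-trivial N ℕₚ.≤-refl ⟨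
  prodTo (M ∸ suc N ℕ.+ suc N) distinctFactor N  ≡⟨ cong (λ K → prodTo K distinctFactor N) (ℕₚ.m∸n+n≡m N<M) ⟩
  prodTo M distinctFactor N                      ∎
  where
  open ≡-Reasoning
  high-factors-trivial : ∀ i → suc N ≤ i → distinctFactor i ≈[ suc N ] 𝟙
  high-factors-trivial i N<i n n≤N = trans (cong (_+_ (𝟙 n)) (vanishesBelow-X^ (suc i) n (ℕₚ.<-≤-trans n≤N (ℕₚ.m≤n⇒m≤1+n N<i))))
                                           (ℤₚ.+-identityʳ (𝟙 n))

termA : ℕ → Series
termA n = pow X (n ℕ.* n) ⊛ inv (poch minusQ (pow X 2) n)

termA≈ : ∀ t → termA t ≈ (X^ (t ℕ.* t)) ⊛ inv (prodTo t oddFactor)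
termA≈ t = ⊛-cong (pow-X (t ℕ.* t))
  (inv-cong (trans (poch[-q,q²]≈ t 0) (prodTo-oddFactor-constantTerm t)) (poch[-q,q²]≈ t))

termA-vanishes : ∀ t → VanishesBelow t (termA t)
termA-vanishes zero = vanishesBelow-0 (termA zero)
termA-vanishes t@(suc _) = vanishesBelow-cong (≈-sym (termA≈ t))
  (vanishesBelow-weaken (ℕₚ.≤-trans (ℕₚ.m≤m*n t t) (ℕₚ.m≤m+n (t ℕ.* t) 0))
    (vanishesBelow-⊛ (t ℕ.* t) 0 {g = inv (prodTo t oddFactor)} (vanishesBelow-X^ (t ℕ.* t)) (vanishesBelow-0 _)))

subsetGF-1 : ∀ M → subsetGF M (λ _ → + 1) ≈ prodTo M distinctFactor
subsetGF-1 M = begin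
  subsetGF M (λ _ → + 1)               ≈⟨ subsetGF-cong M (λ π → sym (weight-1 M π)) ⟩
  subsetGF M (weight (λ _ _ → + 1) M)  ≈⟨ subsetGF-weight (λ _ _ → + 1) M ⟩
  prodTo M (partFactor (λ _ _ → + 1))  ≈⟨ prodTo-cong M (λ i _ n → cong₂ _+_ (ℤₚ.*-identityˡ (𝟙 n)) (ℤₚ.*-identityˡ ((X^ suc i) n))) ⟩
  prodTo M distinctFactor              ∎
  where
  open ≈-Reasoning
  weight-1 : ∀ M π → weight (λ _ _ → + 1) M π ≡ + 1
  weight-1 zero π = refl
  weight-1 (suc M) π = trans (ℤₚ.*-identityʳ _) (weight-1 M π)

subsetGF-run : ∀ j e → let M = e ℕ.+ double (suc j) in
  subsetGF M (λ π → runIndicator π 1 (suc j)) ≈ prodTo M distinctFactor ⊛ termA (suc j)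
subsetGF-run j e = begin
  subsetGF M (λ π → runIndicator π 1 (suc j))    ≈⟨ subsetGF-cong M (λ π → runIndicator≡weight π j e) ⟩
  subsetGF M (weight (runWeight j) M)            ≈⟨ subsetGF-weight (runWeight j) M ⟩
  prodTo M (partFactor (runWeight j))            ≈⟨ ⊛-inv-transpose (prodTo (suc j) oddFactor) (prodTo-oddFactor-constantTerm (suc j)) (runFactors j e) ⟩
  ((X^ sq) ⊛ P) ⊛ inv (prodTo (suc j) oddFactor) ≈⟨ solve 3 (λ x p i → (x :* p) :* i := p :* (x :* i)) ≈-refl (X^ sq) P (inv (prodTo (suc j) oddFactor)) ⟩
  P ⊛ ((X^ sq) ⊛ inv (prodTo (suc j) oddFactor)) ≈⟨ ⊛-congʳ P (termA≈ (suc j)) ⟨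
  P ⊛ termA (suc j)                              ∎
  where
  open ≈-Reasoning
  M = e ℕ.+ double (suc j)
  P = prodTo M distinctFactor
  sq = suc j ℕ.* suc j

⊛-𝟙⊕2* : ∀ f g n → (f ⊛ (𝟙 ⊕ scale (+ 2) g)) n ≡ f n + + 2 * (f ⊛ g) n
⊛-𝟙⊕2* f g n = trans (solve 2 (λ f h → f :* (con (+ 1) :+ h) := f :+ f :* h) ≈-refl f (scale (+ 2) g) n)
                     (cong (_+_ (f n)) (⊛-scaleʳ (+ 2) f g n))

seriesA-expansion : ∀ {N M} → N < M → seriesA N ≡ pochInf minusQ X N + + 2 * sumTo N (λ j → (prodTo M distinctFactor ⊛ termA (suc j)) N)
seriesA-expansion {N} {M} N<M = begin
  seriesA N
    ≡⟨ ⊛-𝟙⊕2* (pochInf minusQ X) (infSum1 termA) N ⟩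
  pochInf minusQ X N + + 2 * (pochInf minusQ X ⊛ infSum1 termA) N
    ≡⟨ cong (λ s → pochInf minusQ X N + + 2 * s) (⊛-cong-≈[] truncate-product (infSum1≈[]sumToSeries termA termA-vanishes N) N ℕₚ.≤-refl) ⟩
  pochInf minusQ X N + + 2 * (P ⊛ sumToSeries N (termA ∘ suc)) N
    ≡⟨ cong (λ s → pochInf minusQ X N + + 2 * s) (⊛-sumToSeries P N (termA ∘ suc) N) ⟩
  pochInf minusQ X N + + 2 * sumTo N (λ j → (P ⊛ termA (suc j)) N) ∎
  where
  open ≡-Reasoning
  P = prodTo M distinctFactor
  truncate-product : pochInf minusQ X ≈[ suc N ] P
  truncate-product n (s≤s n≤N) = pochInf[-q,q]≡prodTo (ℕₚ.≤-<-trans n≤N N<M)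

module _ (D : ℕ → List (List ℕ))
         (D-spec : ∀ n π → (π ∈ D n) ⇔ IsDistinctPartition n π)
         (D-unique : ∀ n → Unique (D n)) where

  D↭filter : ∀ {N M} → N ≤ M → D N ↭ filter (λ π → sum π ℕ.≟ N) (decreasingSubsets M)
  D↭filter {N} {M} N≤M = ∼bag⇒↭ (unique∧set⇒bag (D-unique N)
    (Uniqueₚ.filter⁺ (λ π → sum π ℕ.≟ N) (decreasingSubsets-unique M)) (mk⇔ to from))
    where
    to : ∀ {π} → π ∈ D N → π ∈ filter (λ π → sum π ℕ.≟ N) (decreasingSubsets M)
    to {π} π∈D with Equivalence.to (D-spec N π) π∈D
    ... | refl , π>0 , π↘ = ∈-filter⁺ (λ π → sum π ℕ.≟ N)
      (∈-decreasingSubsets⁺ M (π↘ , π>0 , All.map (λ x≤N → ℕₚ.≤-trans x≤N N≤M) (All.tabulate (∈⇒≤sum π)))) refl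
    from : ∀ {π} → π ∈ filter (λ π → sum π ℕ.≟ N) (decreasingSubsets M) → π ∈ D N
    from {π} π∈ with ∈-filter⁻ (λ π → sum π ℕ.≟ N) π∈
    ... | π∈subsets , sum≡N with ∈-decreasingSubsets⁻ M π∈subsets
    ...   | π↘ , π>0 , _ = Equivalence.from (D-spec N π) (sum≡N , π>0 , π↘)

  sumOver-D≡subsetGF : ∀ {N M} → N ≤ M → (h : List ℕ → ℤ) → sumOver (D N) h ≡ subsetGF M h N
  sumOver-D≡subsetGF {N} {M} N≤M h =
    trans (sumOver-↭ h (D↭filter N≤M)) (sumOver-filter-sum≡ N (decreasingSubsets M) h)

  moex-sum-expansion : ∀ N → + sum (map moex (D N)) ≡
    sumOver (D N) (λ _ → + 1) + + 2 * sumTo N (λ j → sumOver (D N) (λ π → runIndicator π 1 (suc j)))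
  moex-sum-expansion N = begin
    + sum (map moex (D N))
      ≡⟨ sum-map≡sumOver moex (D N) ⟩
    sumOver (D N) (λ π → + moex π)
      ≡⟨ sumOver-cong∈ (D N) moex≡ ⟩
    sumOver (D N) (λ π → + 1 + + 2 * sumTo N (λ j → run j π))
      ≡⟨ sumOver-+ (D N) (λ _ → + 1) (λ π → + 2 * sumTo N (λ j → run j π)) ⟩
    sumOver (D N) (λ _ → + 1) + sumOver (D N) (λ π → + 2 * sumTo N (λ j → run j π))
      ≡⟨ cong (_+_ (sumOver (D N) (λ _ → + 1))) (*-distribˡ-sumOver (D N) (+ 2) (λ π → sumTo N (λ j → run j π))) ⟨
    sumOver (D N) (λ _ → + 1) + + 2 * sumOver (D N) (λ π → sumTo N (λ j → run j π))
      ≡⟨ cong (λ s → sumOver (D N) (λ _ → + 1) + + 2 * s) (sumOver-sumTo (D N) N (λ π j → run j π)) ⟩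
    sumOver (D N) (λ _ → + 1) + + 2 * sumTo N (λ j → sumOver (D N) (run j)) ∎
    where
    open ≡-Reasoning
    run : ℕ → List ℕ → ℤ
    run j π = runIndicator π 1 (suc j)
    moex≡ : ∀ π → π ∈ D N → + moex π ≡ + 1 + + 2 * sumTo N (λ j → run j π)
    moex≡ π π∈D with Equivalence.to (D-spec N π) π∈D
    ... | sum≡N , π>0 , π↘ = moex-expansion π N π↘ (subst (length π ≤_) sum≡N (length≤sum π π>0))

  moex-sum≡seriesA : ∀ N → + sum (map moex (D N)) ≡ seriesA N
  moex-sum≡seriesA N = begin
    + sum (map moex (D N))
      ≡⟨ moex-sum-expansion N ⟩
    sumOver (D N) (λ _ → + 1) + + 2 * sumTo N (λ j → sumOver (D N) (λ π → runIndicator π 1 (suc j)))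
      ≡⟨ cong₂ (λ a s → a + + 2 * s) count-all (sumTo-cong≤ N count-runs) ⟩
    pochInf minusQ X N + + 2 * sumTo N (λ j → (prodTo M distinctFactor ⊛ termA (suc j)) N)
      ≡⟨ seriesA-expansion N<M ⟨
    seriesA N ∎
    where
    open ≡-Reasoning
    M = double (suc N)
    N≤double : ∀ N → N ≤ double N
    N≤double zero = z≤n
    N≤double (suc N) = s≤s (ℕₚ.m≤n⇒m≤1+n (N≤double N))
    N<M : N < M
    N<M = s≤s (ℕₚ.m≤n⇒m≤1+n (N≤double N))
    count-all : sumOver (D N) (λ _ → + 1) ≡ pochInf minusQ X N
    count-all = trans (sumOver-D≡subsetGF (ℕₚ.<⇒≤ N<M) (λ _ → + 1))
                      (trans (subsetGF-1 M N) (sym (pochInf[-q,q]≡prodTo N<M)))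
    count-runs : ∀ j → j ≤ N → sumOver (D N) (λ π → runIndicator π 1 (suc j)) ≡ (prodTo M distinctFactor ⊛ termA (suc j)) N
    count-runs j j≤N = trans (sumOver-D≡subsetGF (ℕₚ.<⇒≤ N<M) (λ π → runIndicator π 1 (suc j)))
      (subst (λ K → subsetGF K (λ π → runIndicator π 1 (suc j)) N ≡ (prodTo K distinctFactor ⊛ termA (suc j)) N)
             (ℕₚ.m∸n+n≡m (double-mono (s≤s j≤N)))
             (subsetGF-run j (M ∸ double (suc j)) N))

-- The form with σ*(-q)

termC : ℕ → Series
termC n = pow X (n ℕ.* n) ⊛ inv (poch X (pow X 2) n)

subNeg-poch[q,q²] : ∀ t → subNeg (poch X (pow X 2) t) ≈ prodTo t oddFactor
subNeg-poch[q,q²] t = ≈-trans (subNeg-prodTo t _) (prodTo-cong t (λ s _ → factor s))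
  where
  factor : ∀ s → subNeg (𝟙 ⊖ (X ⊛ pow (pow X 2) s)) ≈ oddFactor s
  factor s n = begin
    subNeg (𝟙 ⊖ (X ⊛ pow (pow X 2) s)) n                     ≡⟨ subNeg-⊖ 𝟙 (X ⊛ pow (pow X 2) s) n ⟩
    subNeg 𝟙 n - subNeg (X ⊛ pow (pow X 2) s) n              ≡⟨ cong₂ _-_ (subNeg-𝟙 n) (subNeg-cong (X⊛pow-X² s) n) ⟩
    𝟙 n - subNeg (X^ suc (double s)) n                       ≡⟨ cong (_-_ (𝟙 n)) (subNeg-X^ (suc (double s)) n) ⟩
    𝟙 n - - sgn (double s) * (X^ suc (double s)) n           ≡⟨ cong (λ σ → 𝟙 n - - σ * (X^ suc (double s)) n) (sgn-double s) ⟩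
    𝟙 n - - + 1 * (X^ suc (double s)) n                      ≡⟨ cancel (𝟙 n) ((X^ suc (double s)) n) ⟩
    𝟙 n + (X^ suc (double s)) n                              ∎
    where
    open ≡-Reasoning
    cancel : ∀ a b → a - - + 1 * b ≡ a + b
    cancel = solve-∀

poch[q,q²]-constantTerm : ∀ t → poch X (pow X 2) t 0 ≡ + 1
poch[q,q²]-constantTerm t = trans (sym (subNeg-constantTerm (poch X (pow X 2) t)))
  (trans (subNeg-poch[q,q²] t 0) (prodTo-oddFactor-constantTerm t))

subNeg-termC : ∀ m → subNeg (termC m) ≈ scale (sgn m) (termA m)
subNeg-termC m = begin
  subNeg (termC m)
    ≈⟨ subNeg-⊛ (pow X (m ℕ.* m)) (inv (poch X (pow X 2) m)) ⟩
  subNeg (pow X (m ℕ.* m)) ⊛ subNeg (inv (poch X (pow X 2) m))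
    ≈⟨ ⊛-cong square-part inverse-part ⟩
  scale (sgn m) (X^ (m ℕ.* m)) ⊛ inv (prodTo m oddFactor)
    ≈⟨ ⊛-scaleˡ (sgn m) (X^ (m ℕ.* m)) (inv (prodTo m oddFactor)) ⟩
  scale (sgn m) ((X^ (m ℕ.* m)) ⊛ inv (prodTo m oddFactor))
    ≈⟨ scale-cong (sgn m) (termA≈ m) ⟨
  scale (sgn m) (termA m) ∎
  where
  open ≈-Reasoning
  square-part : subNeg (pow X (m ℕ.* m)) ≈ scale (sgn m) (X^ (m ℕ.* m))
  square-part = ≈-trans (subNeg-cong (pow-X (m ℕ.* m)))
    (≈-trans (subNeg-X^ (m ℕ.* m)) (λ n → cong (_* (X^ (m ℕ.* m)) n) (sgn-square m)))
  inverse-part : subNeg (inv (poch X (pow X 2) m)) ≈ inv (prodTo m oddFactor)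
  inverse-part = ≈-trans (subNeg-inv (poch X (pow X 2) m) (poch[q,q²]-constantTerm m))
    (inv-cong (trans (subNeg-constantTerm (poch X (pow X 2) m)) (poch[q,q²]-constantTerm m)) (subNeg-poch[q,q²] m))

subNeg-sigmaStar : subNeg sigmaStar ≈ scale (+ 2) (infSum1 termA)
subNeg-sigmaStar = begin
  subNeg sigmaStar
    ≈⟨ subNeg-scale (+ 2) (infSum1 (λ n → scale (sgn n) (termC n))) ⟩
  scale (+ 2) (subNeg (infSum1 (λ n → scale (sgn n) (termC n))))
    ≈⟨ scale-cong (+ 2) (subNeg-infSum1 (λ n → scale (sgn n) (termC n))) ⟩
  scale (+ 2) (infSum1 (λ n → subNeg (scale (sgn n) (termC n))))
    ≈⟨ scale-cong (+ 2) (infSum1-cong (λ n → ≈-trans (subNeg-scale (sgn n) (termC n)) (scale-cong (sgn n) (subNeg-termC n)))) ⟩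
  scale (+ 2) (infSum1 (λ n → scale (sgn n) (scale (sgn n) (termA n))))
    ≈⟨ scale-cong (+ 2) (infSum1-cong sign-squared) ⟩
  scale (+ 2) (infSum1 termA) ∎
  where
  open ≈-Reasoning
  sign-squared : ∀ n → scale (sgn n) (scale (sgn n) (termA n)) ≈ termA n
  sign-squared n k = trans (sym (ℤₚ.*-assoc (sgn n) (sgn n) (termA n k)))
    (trans (cong (_* termA n k) (sgn-*-sgn n)) (ℤₚ.*-identityˡ (termA n k)))

seriesC≈seriesA : seriesC ≈ seriesA
seriesC≈seriesA = ⊛-congʳ (pochInf minusQ X) (⊕-cong (≈-refl {𝟙}) subNeg-sigmaStar)

-- Fine's functional equation

zPow : ℕ → ℕ → Series
zPow s n = scale (sgn n) (X^ (suc (double s) ℕ.* n))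

evenPoch : ℕ → Series
evenPoch n = prodTo n (λ i → 𝟙 ⊖ (X^ double (suc i)))

fineSum : ℕ → ℕ → Series
fineSum L s = sumToSeries L (λ n → evenPoch n ⊛ zPow s n)

fineSum< : ℕ → ℕ → Series
fineSum< zero s = 𝟘
fineSum< (suc L) s = fineSum L (suc s)

zPow-0 : ∀ s → zPow s 0 ≈ 𝟙
zPow-0 s n = trans (ℤₚ.*-identityˡ _) (cong (λ k → (X^ k) n) (ℕₚ.*-zeroʳ (suc (double s))))

zPow-suc : ∀ s n → zPow s (suc n) ≈ negate (X^ suc (double s)) ⊛ zPow s n
zPow-suc s n = ≈-sym (begin
  negate (X^ a) ⊛ zPow s n                          ≈⟨ negate-⊛ (X^ a) (zPow s n) ⟩
  negate ((X^ a) ⊛ zPow s n)                        ≈⟨ (λ k → cong -_ (⊛-scaleʳ (sgn n) (X^ a) (X^ (a ℕ.* n)) k)) ⟩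
  negate (scale (sgn n) ((X^ a) ⊛ (X^ (a ℕ.* n))))  ≈⟨ (λ k → cong (λ x → - (sgn n * x)) (X^-+ a (a ℕ.* n) k)) ⟩
  negate (scale (sgn n) (X^ (a ℕ.+ a ℕ.* n)))       ≈⟨ (λ k → ℤₚ.neg-distribˡ-* (sgn n) ((X^ (a ℕ.+ a ℕ.* n)) k)) ⟩
  scale (sgn (suc n)) (X^ (a ℕ.+ a ℕ.* n))          ≈⟨ scale-cong (sgn (suc n)) (X^-cong (sym (ℕₚ.*-suc a n))) ⟩
  zPow s (suc n)                                   ∎)
  where
  open ≈-Reasoning
  a = suc (double s)

-- q^(2L+2) zₛ^(L+1) = z_{s+1}^(L+1), where zₛ = -q^(2s+1).
X^-zPow-shift : ∀ s L → (X^ double (suc L)) ⊛ zPow s (suc L) ≈ negate (X^ suc (double (suc s))) ⊛ zPow (suc s) L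
X^-zPow-shift s L = begin
  (X^ double (suc L)) ⊛ zPow s (suc L)
    ≈⟨ ⊛-scaleʳ (sgn (suc L)) (X^ double (suc L)) (X^ (a ℕ.* suc L)) ⟩
  scale (sgn (suc L)) ((X^ double (suc L)) ⊛ (X^ (a ℕ.* suc L)))
    ≈⟨ scale-cong (sgn (suc L)) (≈-trans (X^-+ (double (suc L)) (a ℕ.* suc L)) (X^-cong exponents)) ⟩
  scale (sgn (suc L)) (X^ (b ℕ.+ b ℕ.* L))
    ≈⟨ scale-cong (sgn (suc L)) (X^-+ b (b ℕ.* L)) ⟨
  scale (sgn (suc L)) ((X^ b) ⊛ (X^ (b ℕ.* L)))
    ≈⟨ (λ k → ℤₚ.neg-distribˡ-* (sgn L) (((X^ b) ⊛ (X^ (b ℕ.* L))) k)) ⟨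
  negate (scale (sgn L) ((X^ b) ⊛ (X^ (b ℕ.* L))))
    ≈⟨ (λ k → cong -_ (⊛-scaleʳ (sgn L) (X^ b) (X^ (b ℕ.* L)) k)) ⟨
  negate ((X^ b) ⊛ zPow (suc s) L)
    ≈⟨ negate-⊛ (X^ b) (zPow (suc s) L) ⟨
  negate (X^ b) ⊛ zPow (suc s) L ∎
  where
  open ≈-Reasoning
  a = suc (double s)
  b = suc (double (suc s))
  arithmetic : ∀ s L → 2 ℕ.* suc L ℕ.+ suc (2 ℕ.* s) ℕ.* suc L ≡ suc (2 ℕ.* suc s) ℕ.+ suc (2 ℕ.* suc s) ℕ.* L
  arithmetic = ℕ-Solver.solve-∀
  exponents : double (suc L) ℕ.+ a ℕ.* suc L ≡ b ℕ.+ b ℕ.* L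
  exponents = trans (cong₂ (λ x y → x ℕ.+ suc y ℕ.* suc L) (double≡2* (suc L)) (double≡2* s))
                    (trans (arithmetic s L) (cong (λ y → suc y ℕ.+ suc y ℕ.* L) (sym (double≡2* (suc s)))))

fineSum<-suc : ∀ L s → fineSum< (suc L) s ≈ fineSum< L s ⊕ (evenPoch L ⊛ zPow (suc s) L)
fineSum<-suc zero s n = sym (ℤₚ.+-identityˡ _)
fineSum<-suc (suc L) s n = refl

-- Truncation at L of Fine's functional equation (1 - z) F(z) = 1 - z q² F(z q²)
-- for F(z) = Σ (q²;q²)ₙ zⁿ at z = -q^(2s+1).
fineSum-recurrence : ∀ L s →
  (fineSum L s ⊛ oddFactor s) ⊕ (evenPoch L ⊛ zPow s (suc L)) ≈ 𝟙 ⊕ ((X^ suc (double (suc s))) ⊛ fineSum< L s)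
fineSum-recurrence zero s = begin
  ((𝟙 ⊛ zPow s 0) ⊛ (𝟙 ⊕ u)) ⊕ (𝟙 ⊛ zPow s 1)
    ≈⟨ ⊕-cong (⊛-congˡ (𝟙 ⊕ u) (⊛-congʳ 𝟙 (zPow-0 s)))
              (⊛-congʳ 𝟙 (≈-trans (zPow-suc s 0) (⊛-congʳ (negate u) (zPow-0 s)))) ⟩
  ((𝟙 ⊛ 𝟙) ⊛ (𝟙 ⊕ u)) ⊕ (𝟙 ⊛ (negate u ⊛ 𝟙))
    ≈⟨ solve 2 (λ u m → ((con (+ 1) :* con (+ 1)) :* (con (+ 1) :+ u)) :+ (con (+ 1) :* ((:- u) :* con (+ 1)))
                        := con (+ 1) :+ (m :* con (+ 0))) ≈-refl u m ⟩
  𝟙 ⊕ (m ⊛ 𝟘) ∎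
  where
  open ≈-Reasoning
  u = X^ suc (double s)
  m = X^ suc (double (suc s))
fineSum-recurrence (suc L) s = begin
  ((fineSum L s ⊕ ((P ⊛ (𝟙 ⊖ w)) ⊛ Z)) ⊛ (𝟙 ⊕ u)) ⊕ ((P ⊛ (𝟙 ⊖ w)) ⊛ zPow s (suc (suc L)))
    ≈⟨ ⊕-cong (≈-refl {(fineSum L s ⊕ ((P ⊛ (𝟙 ⊖ w)) ⊛ Z)) ⊛ (𝟙 ⊕ u)}) (⊛-congʳ (P ⊛ (𝟙 ⊖ w)) (zPow-suc s (suc L))) ⟩
  ((fineSum L s ⊕ ((P ⊛ (𝟙 ⊖ w)) ⊛ Z)) ⊛ (𝟙 ⊕ u)) ⊕ ((P ⊛ (𝟙 ⊖ w)) ⊛ (negate u ⊛ Z))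
    ≈⟨ solve 5 (λ g p z u w → ((g :+ ((p :* (con (+ 1) :+ :- w)) :* z)) :* (con (+ 1) :+ u)) :+ ((p :* (con (+ 1) :+ :- w)) :* ((:- u) :* z))
                              := ((g :* (con (+ 1) :+ u)) :+ (p :* z)) :+ (:- (p :* (w :* z)))) ≈-refl (fineSum L s) P Z u w ⟩
  ((fineSum L s ⊛ (𝟙 ⊕ u)) ⊕ (P ⊛ Z)) ⊕ negate (P ⊛ (w ⊛ Z))
    ≈⟨ ⊕-cong (fineSum-recurrence L s) (λ n → cong -_ (⊛-congʳ P (X^-zPow-shift s L) n)) ⟩
  (𝟙 ⊕ (m ⊛ fineSum< L s)) ⊕ negate (P ⊛ (negate m ⊛ zPow (suc s) L))
    ≈⟨ solve 4 (λ m g p y → (con (+ 1) :+ (m :* g)) :+ (:- (p :* ((:- m) :* y))) := con (+ 1) :+ (m :* (g :+ (p :* y))))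
               ≈-refl m (fineSum< L s) P (zPow (suc s) L) ⟩
  𝟙 ⊕ (m ⊛ (fineSum< L s ⊕ (P ⊛ zPow (suc s) L)))
    ≈⟨ ⊕-cong (≈-refl {𝟙}) (⊛-congʳ m (fineSum<-suc L s)) ⟨
  𝟙 ⊕ (m ⊛ fineSum< (suc L) s) ∎
  where
  open ≈-Reasoning
  P = evenPoch L
  Z = zPow s (suc L)
  u = X^ suc (double s)
  m = X^ suc (double (suc s))
  w = X^ double (suc L)

zPow-vanishes : ∀ s n → VanishesBelow n (zPow s n)
zPow-vanishes s n = vanishesBelow-scale (sgn n) (vanishesBelow-weaken (ℕₚ.m≤n*m n (suc (double s))) (vanishesBelow-X^ _))

evenPoch-zPow-vanishes : ∀ s m n → VanishesBelow n (evenPoch m ⊛ zPow s n)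
evenPoch-zPow-vanishes s m n = vanishesBelow-⊛ 0 n (vanishesBelow-0 (evenPoch m)) (zPow-vanishes s n)

fineSum-step : ∀ L s →
  fineSum (suc L) s ≈[ suc (suc L) ] (𝟙 ⊕ ((X^ suc (double (suc s))) ⊛ fineSum L (suc s))) ⊛ inv (oddFactor s)
fineSum-step L s = ≈[]-trans
  (≈⇒≈[] (suc (suc L)) (⊛-inv-transpose (oddFactor s) refl ≈-refl))
  (⊛-cong-≈[] {g = inv (oddFactor s)} drop-remainder (λ _ _ → refl))
  where
  drop-remainder : fineSum (suc L) s ⊛ oddFactor s ≈[ suc (suc L) ] 𝟙 ⊕ ((X^ suc (double (suc s))) ⊛ fineSum L (suc s))
  drop-remainder n n<L+2 = trans
    (sym (trans (cong (_+_ ((fineSum (suc L) s ⊛ oddFactor s) n)) (evenPoch-zPow-vanishes s (suc L) (suc (suc L)) n n<L+2))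
                (ℤₚ.+-identityʳ _)))
    (fineSum-recurrence (suc L) s n)

partialA : ℕ → Series
partialA zero = 𝟘
partialA (suc k) = partialA k ⊕ termA (suc k)

partialA≈sumToSeries : ∀ N → partialA (suc N) ≈ sumToSeries N (termA ∘ suc)
partialA≈sumToSeries zero n = ℤₚ.+-identityˡ _
partialA≈sumToSeries (suc N) = ⊕-cong (partialA≈sumToSeries N) (≈-refl {termA (suc (suc N))})

-- Iterating fineSum-step k times: q F(-q) = Σ_{t<k} termA (t+1) + q^((k+1)²) F(z_k) / (-q;q²)_k.
fineSum-unroll : ∀ k L {V} → V ≤ suc L →
  (X^ 1) ⊛ fineSum (k ℕ.+ L) 0 ≈[ V ] partialA k ⊕ (((X^ (suc k ℕ.* suc k)) ⊛ inv (prodTo k oddFactor)) ⊛ fineSum L k)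
fineSum-unroll zero L {V} _ = ≈⇒≈[] V (begin
  (X^ 1) ⊛ fineSum L 0                                   ≈⟨ ⊛-congˡ (fineSum L 0) (⊛-identityʳ (X^ 1)) ⟨
  ((X^ 1) ⊛ 𝟙) ⊛ fineSum L 0                             ≈⟨ ⊛-congˡ (fineSum L 0) (⊛-congʳ (X^ 1) inv-𝟙) ⟨
  ((X^ 1) ⊛ inv 𝟙) ⊛ fineSum L 0                         ≈⟨ (λ n → ℤₚ.+-identityˡ _) ⟨
  𝟘 ⊕ (((X^ 1) ⊛ inv 𝟙) ⊛ fineSum L 0)                   ∎)
  where open ≈-Reasoning
fineSum-unroll (suc k) L {V} V≤1+L = begin
  (X^ 1) ⊛ fineSum (suc k ℕ.+ L) 0
    ≡⟨ cong (λ K → (X^ 1) ⊛ fineSum K 0) (sym (ℕₚ.+-suc k L)) ⟩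
  (X^ 1) ⊛ fineSum (k ℕ.+ suc L) 0
    ∼⟨ fineSum-unroll k (suc L) (ℕₚ.m≤n⇒m≤1+n V≤1+L) ⟩
  partialA k ⊕ ((E ⊛ I) ⊛ fineSum (suc L) k)
    ∼⟨ ⊕-cong-≈[] {partialA k} (λ _ _ → refl)
         (⊛-cong-≈[] {E ⊛ I} (λ _ _ → refl) (λ n n<V → fineSum-step L k n (ℕₚ.<-≤-trans n<V (ℕₚ.m≤n⇒m≤1+n V≤1+L)))) ⟩
  partialA k ⊕ ((E ⊛ I) ⊛ ((𝟙 ⊕ (m ⊛ fineSum L (suc k))) ⊛ inv (oddFactor k)))
    ∼⟨ ≈⇒≈[] V rearrange ⟩
  (partialA k ⊕ (E ⊛ (I ⊛ inv (oddFactor k)))) ⊕ (((E ⊛ m) ⊛ (I ⊛ inv (oddFactor k))) ⊛ fineSum L (suc k))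
    ∼⟨ ≈⇒≈[] V (⊕-cong (⊕-cong (≈-refl {partialA k}) (≈-trans (⊛-congʳ E combine-inverses) (≈-sym (termA≈ (suc k)))))
                       (⊛-congˡ (fineSum L (suc k)) (⊛-cong (≈-trans (X^-+ sq (suc (double (suc k)))) (X^-cong next-square)) combine-inverses))) ⟩
  partialA (suc k) ⊕ (((X^ (suc (suc k) ℕ.* suc (suc k))) ⊛ inv (prodTo (suc k) oddFactor)) ⊛ fineSum L (suc k)) ∎
  where
  open import Relation.Binary.Reasoning.Base.Single (_≈[ V ]_) ≈[]-refl ≈[]-trans
  sq = suc k ℕ.* suc k
  E = X^ sq
  I = inv (prodTo k oddFactor)
  m = X^ suc (double (suc k))
  rearrange : partialA k ⊕ ((E ⊛ I) ⊛ ((𝟙 ⊕ (m ⊛ fineSum L (suc k))) ⊛ inv (oddFactor k)))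
            ≈ (partialA k ⊕ (E ⊛ (I ⊛ inv (oddFactor k)))) ⊕ (((E ⊛ m) ⊛ (I ⊛ inv (oddFactor k))) ⊛ fineSum L (suc k))
  rearrange = solve 6 (λ a e i m g r → a :+ ((e :* i) :* ((con (+ 1) :+ (m :* g)) :* r))
                                      := (a :+ (e :* (i :* r))) :+ (((e :* m) :* (i :* r)) :* g))
                      ≈-refl (partialA k) E I m (fineSum L (suc k)) (inv (oddFactor k))
  combine-inverses : I ⊛ inv (oddFactor k) ≈ inv (prodTo (suc k) oddFactor)
  combine-inverses = ≈-sym (inv-⊛ (prodTo k oddFactor) (oddFactor k) (prodTo-oddFactor-constantTerm k) refl)
  next-square : sq ℕ.+ suc (double (suc k)) ≡ suc (suc k) ℕ.* suc (suc k)
  next-square = trans (cong (λ d → sq ℕ.+ suc d) (double≡2* (suc k))) (arithmetic k)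
    where
    arithmetic : ∀ k → suc k ℕ.* suc k ℕ.+ suc (2 ℕ.* suc k) ≡ suc (suc k) ℕ.* suc (suc k)
    arithmetic = ℕ-Solver.solve-∀

fineSum-limit : ∀ N → (X^ 1) ⊛ fineSum (suc N ℕ.+ N) 0 ≈[ suc N ] partialA (suc N)
fineSum-limit N = ≈[]-trans (fineSum-unroll (suc N) N ℕₚ.≤-refl) λ n n≤N →
  trans (cong (_+_ (partialA (suc N) n)) (tail-vanishes n n≤N)) (ℤₚ.+-identityʳ _)
  where
  sq = suc (suc N) ℕ.* suc (suc N)
  tail-vanishes : VanishesBelow (suc N) (((X^ sq) ⊛ inv (prodTo (suc N) oddFactor)) ⊛ fineSum N (suc N))
  tail-vanishes = vanishesBelow-weaken N+1≤sq+0+0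
    (vanishesBelow-⊛ (sq ℕ.+ 0) 0 {g = fineSum N (suc N)}
      (vanishesBelow-⊛ sq 0 {g = inv (prodTo (suc N) oddFactor)} (vanishesBelow-X^ sq) (vanishesBelow-0 _))
      (vanishesBelow-0 _))
    where
    N+1≤sq+0+0 : suc N ≤ sq ℕ.+ 0 ℕ.+ 0
    N+1≤sq+0+0 = ℕₚ.≤-trans (ℕₚ.n≤1+n (suc N)) (ℕₚ.≤-trans (ℕₚ.m≤m*n (suc (suc N)) (suc (suc N)))
                   (ℕₚ.≤-trans (ℕₚ.m≤m+n sq 0) (ℕₚ.m≤m+n (sq ℕ.+ 0) 0)))

termB : ℕ → Series
termB n = scale (sgn (n ∸ 1)) (pow X n ⊛ poch (pow X 2) (pow X 2) (n ∸ 1))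

termB-suc : ∀ j → termB (suc j) ≈ (X^ 1) ⊛ (evenPoch j ⊛ zPow 0 j)
termB-suc j = begin
  scale (sgn j) (pow X (suc j) ⊛ poch (pow X 2) (pow X 2) j)
    ≈⟨ scale-cong (sgn j) (⊛-cong (≈-trans (pow-X (suc j)) (≈-sym (X^-+ 1 j))) poch[q²,q²]≈evenPoch) ⟩
  scale (sgn j) (((X^ 1) ⊛ (X^ j)) ⊛ evenPoch j)
    ≈⟨ scale≈const-⊛ (sgn j) (((X^ 1) ⊛ (X^ j)) ⊛ evenPoch j) ⟩
  const (sgn j) ⊛ (((X^ 1) ⊛ (X^ j)) ⊛ evenPoch j)
    ≈⟨ solve 4 (λ c x y p → c :* ((x :* y) :* p) := x :* (p :* (c :* y))) ≈-refl (const (sgn j)) (X^ 1) (X^ j) (evenPoch j) ⟩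
  (X^ 1) ⊛ (evenPoch j ⊛ (const (sgn j) ⊛ (X^ j)))
    ≈⟨ ⊛-congʳ (X^ 1) (⊛-congʳ (evenPoch j) (≈-trans (≈-sym (scale≈const-⊛ (sgn j) (X^ j))) (scale-cong (sgn j) (X^-cong (sym (ℕₚ.*-identityˡ j)))))) ⟩
  (X^ 1) ⊛ (evenPoch j ⊛ zPow 0 j) ∎
  where
  open ≈-Reasoning
  poch[q²,q²]≈evenPoch : poch (pow X 2) (pow X 2) j ≈ evenPoch j
  poch[q²,q²]≈evenPoch = prodTo-cong j (λ i _ n → cong (_-_ (𝟙 n))
    (trans (⊛-cong (pow-X 2) (pow-X² i) n) (X^-+ 2 (double i) n)))

termB-vanishes : ∀ m → VanishesBelow m (termB m)
termB-vanishes zero = vanishesBelow-0 (termB zero)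
termB-vanishes (suc j) = vanishesBelow-cong (≈-sym (termB-suc j))
  (vanishesBelow-⊛ 1 j (vanishesBelow-X^ 1) (evenPoch-zPow-vanishes 0 j j))

infSum1-termB≈infSum1-termA : infSum1 termB ≈ infSum1 termA
infSum1-termB≈infSum1-termA N = begin
  infSum1 termB N                            ≡⟨ infSum1-truncate termB termB-vanishes (ℕₚ.m≤n+m N (suc N)) ⟩
  sumToSeries K (termB ∘ suc) N              ≡⟨ sumTo-cong K (λ j → termB-suc j N) ⟩
  sumToSeries K (λ j → (X^ 1) ⊛ (evenPoch j ⊛ zPow 0 j)) N
                                             ≡⟨ ⊛-sumToSeries (X^ 1) K (λ j → evenPoch j ⊛ zPow 0 j) N ⟨
  ((X^ 1) ⊛ fineSum K 0) N                   ≡⟨ fineSum-limit N N ℕₚ.≤-refl ⟩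
  partialA (suc N) N                         ≡⟨ partialA≈sumToSeries N N ⟩
  sumToSeries N (termA ∘ suc) N              ≡⟨ infSum1-truncate termA termA-vanishes {N} ℕₚ.≤-refl ⟨
  infSum1 termA N                            ∎
  where
  open ≡-Reasoning
  K = suc N ℕ.+ N

seriesB≈seriesA : seriesB ≈ seriesA
seriesB≈seriesA = ⊛-congʳ (pochInf minusQ X) (⊕-cong (≈-refl {𝟙}) (scale-cong (+ 2) infSum1-termB≈infSum1-termA))

theorem2p6 : (D : ℕ → List (List ℕ))
           → (∀ n π → (π ∈ D n) ⇔ IsDistinctPartition n π)
           → (∀ n → Unique (D n))
           → (∀ n → + sum (map moex (D n)) ≡ seriesA n)
             × (∀ n → + sum (map moex (D n)) ≡ seriesB n)
             × (∀ n → + sum (map moex (D n)) ≡ seriesC n)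
theorem2p6 D D-spec D-unique =
  moex≡A , (λ n → trans (moex≡A n) (sym (seriesB≈seriesA n))) , (λ n → trans (moex≡A n) (sym (seriesC≈seriesA n)))
  where
  moex≡A : ∀ n → + sum (map moex (D n)) ≡ seriesA n
  moex≡A = moex-sum≡seriesA D D-spec D-unique
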